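{- Let $n\ge 1$ and let $D$ be a diagram of $[n]^2$. Then the vertex set of the Schubitope $\mathcal{S}_D$ is \[\{x(w)\colon w\in S_n\},\] where for $w\in S_n$, $x(w)=(x_1,\ldots,x_n)$ is the vector such that, for $1\le k\le n$, $x_k$ is the number of appearances of the integer $k$ in the filling $\mathcal{F}_w(D)$.
   Context: $[n]=\{1,\dots,n\}$ and $S_n$ is the set of permutations of $[n]$, written in one-line notation $w=w_1w_2\cdots w_n$. A diagram $D$ of $[n]^2$ is a set of boxes $(i,j)$ of the $n\times n$ grid ($i$ = row index, numbered $1,\dots,n$ top to bottom; $j$ = column index, numbered left to right). For $1\le j\le n$ and $S\subseteq[n]$, let $\mathrm{word}_{j,S}(D)$ be the string obtained by reading column $j$ from top to bottom and recording "(" if $(i,j)\notin D$ and $i\in S$; ")" if $(i,j)\in D$ and $i\notin S$; "$\star$" if $(i,j)\in D$ and $i\in S$ (nothing otherwise). Let $\theta^j_D(S)$ be the number of paired "()"s in $\mathrm{word}_{j,S}(D)$ (standard inside-out parenthesis matching) plus the number of $\star$'s, and $\theta_D(S)=\sum_{j=1}^n\theta^j_D(S)$. The Schubitope is $\mathcal{S}_D=\{x\in\mathbb{R}^n: \sum_{i\in[n]}x_i=\#D,\ \sum_{i\in S}x_i\le\theta_D(S)\text{ for all } S\subsetneq[n]\}$. The filling $\mathcal{F}_w(D)$: each column of $D$ is filled independently. For column $j$, for $k=1,2,\dots,n$ in turn, place $w_k$ into the topmost still-empty box of $D$ in column $j$ whose row index is $\ge w_k$; if no such empty box exists, $w_k$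 is not placed in this column and one proceeds to $w_{k+1}$. $\mathcal{F}_w(D)$ is the union of these column fillings (some boxes may remain empty).
   Formalization: The Schubitope $\mathcal{S}_D$ is taken over ℚ^n instead of $\mathbb{R}^n$, so its vertices are rational points that are extreme among its rational points. -}

module Defs where

open import Data.Nat as ℕ using (ℕ; zero; suc)
open import Data.Bool using (Bool; true; false; _∧_; not; if_then_else_)
open import Data.Fin using (Fin; toℕ)
open import Data.Fin.Properties using (_≟_)
open import Data.Fin.Subset using (Subset; ⊤)
open import Data.Fin.Permutation using (Permutation′; _⟨$⟩ʳ_)
open import Data.List using (List; []; _∷_; map; allFin; foldr; concatMap)
open import Data.Nat.ListAction using (sum)
open import Data.Vec using (lookup)
open import Data.Maybe using (Maybe; just; nothing)
open import Data.Integer using (+_)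
open import Data.Rational using (ℚ; _/_; 0ℚ; 1ℚ; _+_; _*_; _-_; _≤_; _<_)
open import Data.Product using (_×_)
open import Relation.Nullary using (¬_; does)
open import Relation.Binary.PropositionalEquality using (_≡_)

-- A diagram of [n]^2: D i j = true iff the box (row i, column j) is in D.
-- Rows/columns/values are Fin n, i.e. 0-indexed versions of 1..n.
Diagram : ℕ → Set
Diagram n = Fin n → Fin n → Bool

size : ∀ {n} → Diagram n → ℕ
size {n} D = sum (map (λ i → sum (map (λ j → if D i j then 1 else 0) (allFin n))) (allFin n))

data Sym : Set where
  op cl star : Sym

symAt : Bool → Bool → List Sym
symAt true  false = op ∷ []
symAt false true  = cl ∷ []
symAt true  true  = star ∷ []
symAt false false = []

word : ∀ {n} → Diagram n → Fin n → Subset n → List Sym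
word {n} D j S = concatMap (λ i → symAt (lookup S i) (D i j)) (allFin n)

-- number of matched "()" pairs; o = number of currently unmatched "("
pairs : ℕ → List Sym → ℕ
pairs o [] = 0
pairs o (op ∷ r) = pairs (suc o) r
pairs zero (cl ∷ r) = pairs zero r
pairs (suc o) (cl ∷ r) = suc (pairs o r)
pairs o (star ∷ r) = pairs o r

stars : List Sym → ℕ
stars [] = 0
stars (star ∷ r) = suc (stars r)
stars (_ ∷ r) = stars r

θcol : ∀ {n} → Diagram n → Fin n → Subset n → ℕ
θcol D j S = pairs 0 (word D j S) ℕ.+ stars (word D j S)

θ : ∀ {n} → Diagram n → Subset n → ℕ
θ {n} D S = sum (map (λ j → θcol D j S) (allFin n))

toℚ : ℕ → ℚ
toℚ k = (+ k) / 1

sumℚ : ∀ {A : Set} → (A → ℚ) → List A → ℚ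
sumℚ f = foldr (λ a acc → f a + acc) 0ℚ

sumOver : ∀ {n} → Subset n → (Fin n → ℚ) → ℚ
sumOver {n} S x = sumℚ (λ i → if lookup S i then x i else 0ℚ) (allFin n)

InSchubitope : ∀ {n} → Diagram n → (Fin n → ℚ) → Set
InSchubitope {n} D x =
  sumℚ x (allFin n) ≡ toℚ (size D)
  × (∀ (S : Subset n) → ¬ (S ≡ ⊤) → sumOver S x ≤ toℚ (θ D S))

IsVertex : ∀ {n} → Diagram n → (Fin n → ℚ) → Set
IsVertex {n} D x =
  InSchubitope D x
  × (∀ (y z : Fin n → ℚ) (t : ℚ) → InSchubitope D y → InSchubitope D z →
       0ℚ < t → t < 1ℚ → (∀ i → x i ≡ t * y i + (1ℚ - t) * z i) →
       ∀ i → y i ≡ z i)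

member : ∀ {n} → Fin n → List (Fin n) → Bool
member i [] = false
member i (k ∷ ks) = if does (i ≟ k) then true else member i ks

findBox : ∀ {n} → (Fin n → Bool) → List (Fin n) → Fin n → List (Fin n) → Maybe (Fin n)
findBox col occ v [] = nothing
findBox col occ v (i ∷ is) =
  if col i ∧ does (toℕ v ℕ.≤? toℕ i) ∧ not (member i occ)
  then just i else findBox col occ v is

fillCol : ∀ {n} → (Fin n → Bool) → List (Fin n) → List (Fin n) → List (Fin n)
fillCol col occ [] = []
fillCol {n} col occ (v ∷ vs) with findBox col occ v (allFin n)
... | just i  = v ∷ fillCol col (i ∷ occ) vs
... | nothing = fillCol col occ vs

oneLine : ∀ {n} → Permutation′ n → List (Fin n)
oneLine {n} w = map (w ⟨$⟩ʳ_) (allFin n)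

count : ∀ {n} → Fin n → List (Fin n) → ℕ
count k [] = 0
count k (v ∷ vs) = (if does (k ≟ v) then 1 else 0) ℕ.+ count k vs

xw : ∀ {n} → Diagram n → Permutation′ n → Fin n → ℕ
xw {n} D w k = sum (map (λ j → count k (fillCol (λ i → D i j) [] (oneLine w))) (allFin n))

-- In each column, θ_D(S) is the rank of S in a transversal matroid: the largest number of rows of S
-- that can be matched to distinct boxes weakly below them. So θ_D is submodular, and, being a minimum
-- over horizontal cuts, it is attained by the greedy filling: F_w(D) contains at most θ_D(S) entries
-- from any S, and exactly θ_D(S) from each prefix {w₁, …, w_k}. Hence x(w) ∈ 𝒮_D is tight on a maximal
-- chain of sets, which pins it down as a vertex. Conversely, the tight sets of a point of 𝒮_D are closed
-- under ∪ and ∩; at a vertex they also separate any two coordinates i ≠ j (otherwise x ± ε(eᵢ − eⱼ) ∈ 𝒮_D),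
-- so they contain a maximal chain ∅ ⊂ {w₁} ⊂ ⋯ ⊂ [n], and x = x(w) because both are tight on it.

module Submission where

open import Data.Bool using (Bool; true; false; _∧_; _∨_; not; if_then_else_; T)
import Data.Bool.Properties as Boolₚ
open import Data.Empty using (⊥; ⊥-elim)
open import Data.Fin using (Fin; toℕ; fromℕ<) renaming (zero to fzero; suc to fsuc)
open import Data.Fin.Properties using (_≟_; toℕ<n; toℕ-injective; toℕ-fromℕ<; any?)
open import Data.List using (List; []; _∷_; _++_; map; tabulate; allFin; concatMap; take; drop)
open import Data.List.Relation.Unary.All as All using (All; []; _∷_)
open import Data.List.Properties using (map-tabulate; take++drop≡id)
open import Data.List.Membership.Propositional.Properties using (∈-allFin)
open import Data.Maybe using (just; nothing)
open import Data.List.Relation.Binary.Sublist.Propositional using (_⊆_; []; _∷_; _∷ʳ_)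
open import Data.List.Relation.Binary.Sublist.Propositional.Properties using (All-resp-⊆)
open import Data.Product using (∃-syntax; _×_; _,_; proj₁; proj₂)
open import Data.Sum using (_⊎_; inj₁; inj₂)
open import Function using (_∘_; id)
open import Function.Bundles using (Equivalence; _⇔_; mk⇔)
open import Data.Fin.Permutation as Perm using (Permutation′; _⟨$⟩ʳ_; _⟨$⟩ˡ_; inverseˡ; inverseʳ; _∘ₚ_)
open import Relation.Nullary using (¬_; Dec; yes; no; does; _×-dec_)
open import Relation.Nullary.Decidable using (dec-true; dec-false; does-⇔)
open import Relation.Binary.PropositionalEquality
open import Data.Vec using (lookup)
open import Defs

true≢false : true ≢ false
true≢false ()

≡true⊎≡false : ∀ b → b ≡ true ⊎ b ≡ false
≡true⊎≡false true  = inj₁ refl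
≡true⊎≡false false = inj₂ refl

module Combinatorics where

  open import Data.Nat hiding (_≟_)
  open import Data.Nat.Properties hiding (_≟_)
  open import Data.Nat.ListAction using (sum)
  open import Algebra.Properties.CommutativeMonoid.Sum +-0-commutativeMonoid using (∑-permute) renaming (sum to sumᵛ)
  open import Data.List.Relation.Unary.AllPairs using (AllPairs; []; _∷_)
  open import Data.List.Relation.Unary.AllPairs.Properties using (tabulate⁺-<)
  open import Data.Bool.Properties using (∧-zeroʳ; ∧-identityʳ; ∨-zeroʳ; ∨-identityʳ; ∨-conicalˡ; ∨-conicalʳ)
  import Data.Fin.Permutation.Components as PC
  open import Relation.Binary.Definitions using (tri<; tri≈; tri>)
  open import Algebra.Properties.CommutativeSemigroup +-commutativeSemigroup using (interchange; x∙yz≈y∙xz)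

  ∑ : {A : Set} → (A → ℕ) → List A → ℕ
  ∑ f []       = 0
  ∑ f (x ∷ xs) = f x + ∑ f xs

  sum-map≡∑ : {A : Set} (f : A → ℕ) → ∀ xs → sum (map f xs) ≡ ∑ f xs
  sum-map≡∑ f []       = refl
  sum-map≡∑ f (x ∷ xs) = cong (f x +_) (sum-map≡∑ f xs)

  𝟙 : Bool → ℕ
  𝟙 true  = 1
  𝟙 false = 0

  countᵇ : {A : Set} → (A → Bool) → List A → ℕ
  countᵇ p = ∑ (λ x → 𝟙 (p x))

  module _ {A : Set} where

    ∑-cong : {f g : A → ℕ} → (∀ x → f x ≡ g x) → ∀ xs → ∑ f xs ≡ ∑ g xs
    ∑-cong f≗g []       = refl
    ∑-cong f≗g (x ∷ xs) = cong₂ _+_ (f≗g x) (∑-cong f≗g xs)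

    ∑-mono-≤ : {f g : A → ℕ} → (∀ x → f x ≤ g x) → ∀ xs → ∑ f xs ≤ ∑ g xs
    ∑-mono-≤ f≤g []       = z≤n
    ∑-mono-≤ f≤g (x ∷ xs) = +-mono-≤ (f≤g x) (∑-mono-≤ f≤g xs)

    ∑-zero : {f : A → ℕ} → (∀ x → f x ≡ 0) → ∀ xs → ∑ f xs ≡ 0
    ∑-zero f≗0 []       = refl
    ∑-zero f≗0 (x ∷ xs) = cong₂ _+_ (f≗0 x) (∑-zero f≗0 xs)

    ∑-distrib-+ : (f g : A → ℕ) → ∀ xs → ∑ (λ x → f x + g x) xs ≡ ∑ f xs + ∑ g xs
    ∑-distrib-+ f g []       = refl
    ∑-distrib-+ f g (x ∷ xs) = begin
      f x + g x + ∑ (λ x → f x + g x) xs ≡⟨ cong (f x + g x +_) (∑-distrib-+ f g xs) ⟩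
      f x + g x + (∑ f xs + ∑ g xs)      ≡⟨ interchange (f x) (g x) (∑ f xs) (∑ g xs) ⟩
      f x + ∑ f xs + (g x + ∑ g xs)      ∎
      where open ≡-Reasoning

    ∑-congᴬ : {f g : A → ℕ} → ∀ {xs} → All (λ x → f x ≡ g x) xs → ∑ f xs ≡ ∑ g xs
    ∑-congᴬ []             = refl
    ∑-congᴬ (fx≡gx ∷ f≗g) = cong₂ _+_ fx≡gx (∑-congᴬ f≗g)

    countᵇ-none : {p : A → Bool} → ∀ {xs} → All (λ x → p x ≡ false) xs → countᵇ p xs ≡ 0
    countᵇ-none []              = refl
    countᵇ-none (px≡false ∷ ps) rewrite px≡false = countᵇ-none ps

    countᵇ-every : {p : A → Bool} → ∀ {xs} → All (λ x → p x ≡ true) xs → countᵇ p xs ≡ countᵇ (λ _ → true) xs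
    countᵇ-every []             = refl
    countᵇ-every (px≡true ∷ ps) rewrite px≡true = cong suc (countᵇ-every ps)

    ∑-++ : (f : A → ℕ) → ∀ xs ys → ∑ f (xs ++ ys) ≡ ∑ f xs + ∑ f ys
    ∑-++ f []       ys = refl
    ∑-++ f (x ∷ xs) ys = trans (cong (f x +_) (∑-++ f xs ys)) (sym (+-assoc (f x) _ _))

  ∑-comm : {A B : Set} (f : A → B → ℕ) → ∀ xs ys →
           ∑ (λ x → ∑ (f x) ys) xs ≡ ∑ (λ y → ∑ (λ x → f x y) xs) ys
  ∑-comm f []       ys = sym (∑-zero (λ _ → refl) ys)
  ∑-comm f (x ∷ xs) ys =
    trans (cong (∑ (f x) ys +_) (∑-comm f xs ys)) (sym (∑-distrib-+ (f x) _ ys))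

  ∑-tabulate : {A : Set} {n : ℕ} (f : A → ℕ) (g : Fin n → A) → ∑ f (tabulate g) ≡ ∑ (f ∘ g) (allFin n)
  ∑-tabulate {n = zero}  f g = refl
  ∑-tabulate {n = suc n} f g =
    cong (f (g fzero) +_) (trans (∑-tabulate f (g ∘ fsuc)) (sym (∑-tabulate (f ∘ g) fsuc)))

  ∑-map : {A B : Set} (f : B → ℕ) (g : A → B) → ∀ xs → ∑ f (map g xs) ≡ ∑ (f ∘ g) xs
  ∑-map f g []       = refl
  ∑-map f g (x ∷ xs) = cong (f (g x) +_) (∑-map f g xs)

  ∑-allFin≡sumᵛ : ∀ {n} (h : Fin n → ℕ) → ∑ h (allFin n) ≡ sumᵛ h
  ∑-allFin≡sumᵛ {zero}  h = refl
  ∑-allFin≡sumᵛ {suc n} h = cong (h fzero +_) (trans (∑-tabulate h fsuc) (∑-allFin≡sumᵛ (h ∘ fsuc)))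

  ∑-oneLine : ∀ {n} (w : Permutation′ n) (h : Fin n → ℕ) → ∑ h (oneLine w) ≡ ∑ h (allFin n)
  ∑-oneLine {n} w h = begin
    ∑ h (oneLine w)                   ≡⟨ ∑-map h (w ⟨$⟩ʳ_) (allFin n) ⟩
    ∑ (λ i → h (w ⟨$⟩ʳ i)) (allFin n) ≡⟨ ∑-allFin≡sumᵛ (λ i → h (w ⟨$⟩ʳ i)) ⟩
    sumᵛ (λ i → h (w ⟨$⟩ʳ i))         ≡⟨ ∑-permute h w ⟨
    sumᵛ h                            ≡⟨ ∑-allFin≡sumᵛ h ⟨
    ∑ h (allFin n)                    ∎
    where open ≡-Reasoning

  All-take-tabulate : {A : Set} (P : A → Set) → ∀ {m} (g : Fin m → A) k →
                      (∀ j → toℕ j < k → P (g j)) → All P (take k (tabulate g))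
  All-take-tabulate P         g zero    _ = []
  All-take-tabulate P {zero}  g (suc k) _ = []
  All-take-tabulate P {suc m} g (suc k) h =
    h fzero z<s ∷ All-take-tabulate P (g ∘ fsuc) k (λ j j<k → h (fsuc j) (s<s j<k))

  All-drop-tabulate : {A : Set} (P : A → Set) → ∀ {m} (g : Fin m → A) k →
                      (∀ j → k ≤ toℕ j → P (g j)) → All P (drop k (tabulate g))
  All-drop-tabulate P {zero}  g zero    _ = []
  All-drop-tabulate P {zero}  g (suc k) _ = []
  All-drop-tabulate P {suc m} g zero    h = h fzero z≤n ∷ All-drop-tabulate P (g ∘ fsuc) zero (λ j _ → h (fsuc j) z≤n)
  All-drop-tabulate P {suc m} g (suc k) h = All-drop-tabulate P (g ∘ fsuc) k (λ j k≤j → h (fsuc j) (s≤s k≤j))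

  ∑-pick : ∀ {n} (e : Fin n) (f : Fin n → ℕ) → ∑ (λ i → if does (i ≟ e) then f i else 0) (allFin n) ≡ f e
  ∑-pick {suc n} fzero    f = begin
    f fzero + ∑ δ (tabulate fsuc)   ≡⟨ cong (f fzero +_) (∑-tabulate δ fsuc) ⟩
    f fzero + ∑ (δ ∘ fsuc) (allFin n) ≡⟨ cong (f fzero +_) (∑-zero (λ _ → refl) (allFin n)) ⟩
    f fzero + 0                     ≡⟨ +-identityʳ (f fzero) ⟩
    f fzero                         ∎
    where open ≡-Reasoning
          δ = λ i → if does (i ≟ fzero) then f i else 0
  ∑-pick {suc n} (fsuc e) f =
    trans (∑-tabulate (λ i → if does (i ≟ fsuc e) then f i else 0) fsuc) (∑-pick e (f ∘ fsuc))

  𝟙≤1 : ∀ b → 𝟙 b ≤ 1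
  𝟙≤1 true  = ≤-refl
  𝟙≤1 false = z≤n

  𝟙-∨+𝟙-∧ : ∀ a b → 𝟙 (a ∨ b) + 𝟙 (a ∧ b) ≡ 𝟙 a + 𝟙 b
  𝟙-∨+𝟙-∧ true  true  = refl
  𝟙-∨+𝟙-∧ true  false = refl
  𝟙-∨+𝟙-∧ false b     = +-comm (𝟙 b) 0

  𝟙-∧ˡ : ∀ a b → 𝟙 (a ∧ b) ≤ 𝟙 a
  𝟙-∧ˡ true  b = 𝟙≤1 b
  𝟙-∧ˡ false b = z≤n

  𝟙-∧ʳ : ∀ a b → 𝟙 (a ∧ b) ≤ 𝟙 b
  𝟙-∧ʳ true  b = ≤-refl
  𝟙-∧ʳ false b = z≤n

  ≤⇒≤ᵇ≡true : ∀ {m n} → m ≤ n → (m ≤ᵇ n) ≡ true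
  ≤⇒≤ᵇ≡true {m} {n} m≤n = Equivalence.to Boolₚ.T-≡ (≤⇒≤ᵇ m≤n)

  ≤ᵇ≡true⇒≤ : ∀ {m n} → (m ≤ᵇ n) ≡ true → m ≤ n
  ≤ᵇ≡true⇒≤ {m} {n} eq = ≤ᵇ⇒≤ m n (subst T (sym eq) _)

  >⇒≤ᵇ≡false : ∀ {m n} → n < m → (m ≤ᵇ n) ≡ false
  >⇒≤ᵇ≡false {m} {n} n<m with m ≤ᵇ n in eq
  ... | false = refl
  ... | true  = ⊥-elim (<⇒≱ n<m (≤ᵇ≡true⇒≤ eq))

  ≤ᵇ≡false⇒> : ∀ {m n} → (m ≤ᵇ n) ≡ false → n < m
  ≤ᵇ≡false⇒> {m} {n} eq = ≰⇒> (λ m≤n → true≢false (trans (sym (≤⇒≤ᵇ≡true m≤n)) eq))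

  <⇒<ᵇ≡true : ∀ {m n} → m < n → (m <ᵇ n) ≡ true
  <⇒<ᵇ≡true m<n = Equivalence.to Boolₚ.T-≡ (<⇒<ᵇ m<n)

  <ᵇ≡true⇒< : ∀ {m n} → (m <ᵇ n) ≡ true → m < n
  <ᵇ≡true⇒< {m} {n} eq = <ᵇ⇒< m n (subst T (sym eq) _)

  ≥⇒<ᵇ≡false : ∀ {m n} → n ≤ m → (m <ᵇ n) ≡ false
  ≥⇒<ᵇ≡false {m} {n} n≤m with m <ᵇ n in eq
  ... | false = refl
  ... | true  = ⊥-elim (≤⇒≯ n≤m (<ᵇ≡true⇒< eq))

  prefix : ∀ {n} → Permutation′ n → ℕ → Fin n → Bool
  prefix w k i = toℕ (w ⟨$⟩ˡ i) <ᵇ k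

  module _ {n : ℕ} (w : Permutation′ n) where

    prefix-⟨$⟩ʳ : ∀ k j → prefix w k (w ⟨$⟩ʳ j) ≡ (toℕ j <ᵇ k)
    prefix-⟨$⟩ʳ k j = cong (λ i → toℕ i <ᵇ k) (inverseˡ w)

    prefix-take : ∀ k → All (λ v → prefix w k v ≡ true) (take k (oneLine w))
    prefix-take k rewrite map-tabulate id (w ⟨$⟩ʳ_) =
      All-take-tabulate _ (w ⟨$⟩ʳ_) k (λ j j<k → trans (prefix-⟨$⟩ʳ k j) (<⇒<ᵇ≡true j<k))

    prefix-drop : ∀ k → All (λ v → prefix w k v ≡ false) (drop k (oneLine w))
    prefix-drop k rewrite map-tabulate id (w ⟨$⟩ʳ_) =
      All-drop-tabulate _ (w ⟨$⟩ʳ_) k (λ j k≤j → trans (prefix-⟨$⟩ʳ k j) (≥⇒<ᵇ≡false k≤j))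

  Increasing : ∀ {n} → List (Fin n) → Set
  Increasing = AllPairs (λ i j → toℕ i < toℕ j)

  module ColumnRank {n : ℕ} (c : Fin n → Bool) where

    wordOn : (Fin n → Bool) → List (Fin n) → List Sym
    wordOn p is = concatMap (λ i → symAt (p i) (c i)) is

    -- The largest number of rows of p that can be matched injectively to boxes of c weakly below them.
    rank : (Fin n → Bool) → List (Fin n) → ℕ
    rank p []       = 0
    rank p (i ∷ is) = countᵇ c (i ∷ is) ⊓ (𝟙 (p i) + rank p is)

    rank≤countᵇ : ∀ p is → rank p is ≤ countᵇ c is
    rank≤countᵇ p []       = z≤n
    rank≤countᵇ p (i ∷ is) = m⊓n≤m _ _

    private
      ⊓-+-⊓ : ∀ C o m → C ⊓ (o + (C ⊓ suc m)) ≡ C ⊓ (suc o + m)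
      ⊓-+-⊓ C o m with ≤-total C (suc m)
      ... | inj₁ C≤ rewrite m≤n⇒m⊓n≡m C≤ = trans (m≤n⇒m⊓n≡m (m≤n+m C o))
             (sym (m≤n⇒m⊓n≡m (≤-trans C≤ (subst (suc m ≤_) (+-suc o m) (m≤n+m (suc m) o)))))
      ... | inj₂ C≥ rewrite m≥n⇒m⊓n≡n C≥ = cong (C ⊓_) (+-suc o m)

    -- o counts the "(" still unmatched when the reading reaches is.
    pairs+stars≡rank-with : ∀ p o is →
      pairs o (wordOn p is) + stars (wordOn p is) ≡ countᵇ c is ⊓ (o + rank p is)
    pairs+stars≡rank-with p o [] = refl
    pairs+stars≡rank-with p o (i ∷ is) with p i | c i
    ... | false | false rewrite pairs+stars≡rank-with p o is | m≥n⇒m⊓n≡n (rank≤countᵇ p is) = refl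
    ... | true  | false rewrite pairs+stars≡rank-with p (suc o) is = sym (⊓-+-⊓ (countᵇ c is) o (rank p is))
    ... | false | true with o
    ...   | zero rewrite pairs+stars≡rank-with p 0 is | m≥n⇒m⊓n≡n (rank≤countᵇ p is)
                       | m≥n⇒m⊓n≡n (m≤n⇒m≤1+n (rank≤countᵇ p is))
                       | m≥n⇒m⊓n≡n (m≤n⇒m≤1+n (rank≤countᵇ p is)) = refl
    ...   | suc o′ rewrite pairs+stars≡rank-with p o′ is | m≥n⇒m⊓n≡n (m≤n⇒m≤1+n (rank≤countᵇ p is)) = refl
    pairs+stars≡rank-with p o (i ∷ is) | true | true
      rewrite +-suc (pairs o (wordOn p is)) (stars (wordOn p is)) | pairs+stars≡rank-with p o is
            | m≥n⇒m⊓n≡n (rank≤countᵇ p is) | +-suc o (rank p is) = refl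

    pairs+stars≡rank : ∀ p is → pairs 0 (wordOn p is) + stars (wordOn p is) ≡ rank p is
    pairs+stars≡rank p is = trans (pairs+stars≡rank-with p 0 is) (m≥n⇒m⊓n≡n (rank≤countᵇ p is))

    rank-cong : ∀ {p q} → (∀ i → p i ≡ q i) → ∀ is → rank p is ≡ rank q is
    rank-cong p≗q []       = refl
    rank-cong p≗q (i ∷ is) = cong (countᵇ c (i ∷ is) ⊓_) (cong₂ _+_ (cong 𝟙 (p≗q i)) (rank-cong p≗q is))

    rank-mono : ∀ {p q} → (∀ i → 𝟙 (p i) ≤ 𝟙 (q i)) → ∀ is → rank p is ≤ rank q is
    rank-mono p≤q []       = z≤n
    rank-mono p≤q (i ∷ is) = ⊓-monoʳ-≤ (countᵇ c (i ∷ is)) (+-mono-≤ (p≤q i) (rank-mono p≤q is))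

    private
      ⊓-submodular : ∀ C P Q U I mp mq mu mi → U + I ≡ P + Q → I ≤ P → I ≤ Q →
                     mu + mi ≤ mp + mq → mi ≤ mp → mi ≤ mq →
                     C ⊓ (U + mu) + C ⊓ (I + mi) ≤ C ⊓ (P + mp) + C ⊓ (Q + mq)
      ⊓-submodular C P Q U I mp mq mu mi U+I≡P+Q I≤P I≤Q mu+mi≤ mi≤mp mi≤mq
        with ⊓-sel C (P + mp) | ⊓-sel C (Q + mq)
      ... | inj₁ e₁ | inj₁ e₂ rewrite e₁ | e₂ = +-mono-≤ (m⊓n≤m C _) (m⊓n≤m C _)
      ... | inj₁ e₁ | inj₂ e₂ rewrite e₁ | e₂ =
        +-mono-≤ (m⊓n≤m C _) (≤-trans (m⊓n≤n C _) (+-mono-≤ I≤Q mi≤mq))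
      ... | inj₂ e₁ | inj₁ e₂ rewrite e₁ | e₂ = subst (C ⊓ (U + mu) + C ⊓ (I + mi) ≤_) (+-comm C (P + mp))
        (+-mono-≤ (m⊓n≤m C _) (≤-trans (m⊓n≤n C _) (+-mono-≤ I≤P mi≤mp)))
      ... | inj₂ e₁ | inj₂ e₂ rewrite e₁ | e₂ = begin
        C ⊓ (U + mu) + C ⊓ (I + mi) ≤⟨ +-mono-≤ (m⊓n≤n C _) (m⊓n≤n C _) ⟩
        (U + mu) + (I + mi)         ≡⟨ interchange U mu I mi ⟩
        (U + I) + (mu + mi)         ≤⟨ +-mono-≤ (≤-reflexive U+I≡P+Q) mu+mi≤ ⟩
        (P + Q) + (mp + mq)         ≡⟨ interchange P Q mp mq ⟩
        (P + mp) + (Q + mq)         ∎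
        where open ≤-Reasoning

    rank-submodular : ∀ p q is →
      rank (λ i → p i ∨ q i) is + rank (λ i → p i ∧ q i) is ≤ rank p is + rank q is
    rank-submodular p q []       = z≤n
    rank-submodular p q (i ∷ is) =
      ⊓-submodular (countᵇ c (i ∷ is)) (𝟙 (p i)) (𝟙 (q i)) (𝟙 (p i ∨ q i)) (𝟙 (p i ∧ q i))
        (rank p is) (rank q is) (rank (λ i → p i ∨ q i) is) (rank (λ i → p i ∧ q i) is)
        (𝟙-∨+𝟙-∧ (p i) (q i)) (𝟙-∧ˡ (p i) (q i)) (𝟙-∧ʳ (p i) (q i)) (rank-submodular p q is)
        (rank-mono (λ k → 𝟙-∧ˡ (p k) (q k)) is) (rank-mono (λ k → 𝟙-∧ʳ (p k) (q k)) is)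

    rank-none : ∀ is → rank (λ _ → false) is ≡ 0
    rank-none []       = refl
    rank-none (i ∷ is) rewrite rank-none is = ⊓-zeroʳ (countᵇ c (i ∷ is))

    rank-all : ∀ is → rank (λ _ → true) is ≡ countᵇ c is
    rank-all []       = refl
    rank-all (i ∷ is) rewrite rank-all is = m≤n⇒m⊓n≡m (+-monoˡ-≤ (countᵇ c is) (𝟙≤1 (c i)))

    cut : (Fin n → Bool) → List (Fin n) → ℕ → ℕ
    cut p is t = countᵇ (λ i → p i ∧ not (t ≤ᵇ toℕ i)) is + countᵇ (λ i → c i ∧ (t ≤ᵇ toℕ i)) is

    cut-lower-rows : ∀ p k t is → t ≤ suc k → All (λ j → k < toℕ j) is → cut p is t ≡ countᵇ c is
    cut-lower-rows p k t is t≤1+k below = cong₂ _+_ (none-above is below) (all-below is below)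
      where
      t≤ᵇ : ∀ {j} → k < toℕ j → (t ≤ᵇ toℕ j) ≡ true
      t≤ᵇ k<j = ≤⇒≤ᵇ≡true (≤-trans t≤1+k k<j)
      none-above : ∀ is → All (λ j → k < toℕ j) is → countᵇ (λ i → p i ∧ not (t ≤ᵇ toℕ i)) is ≡ 0
      none-above []       []             = refl
      none-above (j ∷ js) (k<j ∷ below) rewrite t≤ᵇ k<j | ∧-zeroʳ (p j) = none-above js below
      all-below : ∀ is → All (λ j → k < toℕ j) is → countᵇ (λ i → c i ∧ (t ≤ᵇ toℕ i)) is ≡ countᵇ c is
      all-below []       []             = refl
      all-below (j ∷ js) (k<j ∷ below) rewrite t≤ᵇ k<j | ∧-identityʳ (c j) = cong (𝟙 (c j) +_) (all-below js below)

    cut-∷-above : ∀ p i is t → (t ≤ᵇ toℕ i) ≡ false → cut p (i ∷ is) t ≡ 𝟙 (p i) + cut p is t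
    cut-∷-above p i is t i<t rewrite i<t | ∧-identityʳ (p i) | ∧-zeroʳ (c i) = +-assoc (𝟙 (p i)) _ _

    cut-∷-below : ∀ p i is t → (t ≤ᵇ toℕ i) ≡ true → All (λ j → toℕ i < toℕ j) is →
                  cut p (i ∷ is) t ≡ countᵇ c (i ∷ is)
    cut-∷-below p i is t t≤i below rewrite t≤i | ∧-identityʳ (c i) | ∧-zeroʳ (p i) = begin
      countᵇ (λ i → p i ∧ not (t ≤ᵇ toℕ i)) is + (𝟙 (c i) + countᵇ (λ i → c i ∧ (t ≤ᵇ toℕ i)) is)
        ≡⟨ x∙yz≈y∙xz (countᵇ (λ i → p i ∧ not (t ≤ᵇ toℕ i)) is) (𝟙 (c i))
                     (countᵇ (λ i → c i ∧ (t ≤ᵇ toℕ i)) is) ⟩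
      𝟙 (c i) + cut p is t
        ≡⟨ cong (𝟙 (c i) +_) (cut-lower-rows p (toℕ i) t is (m≤n⇒m≤1+n (≤ᵇ≡true⇒≤ t≤i)) below) ⟩
      𝟙 (c i) + countᵇ c is ∎
      where open ≡-Reasoning

    -- With rank≡cut-for-some: the rank is the least cut (a König-type min–max).
    rank≤cut : ∀ p is → Increasing is → ∀ t → rank p is ≤ cut p is t
    rank≤cut p []       _               t = z≤n
    rank≤cut p (i ∷ is) (below ∷ incr) t with ≡true⊎≡false (t ≤ᵇ toℕ i)
    ... | inj₁ t≤i = ≤-trans (m⊓n≤m _ _) (≤-reflexive (sym (cut-∷-below p i is t t≤i below)))
    ... | inj₂ i<t = ≤-trans (m⊓n≤n _ _) (≤-trans (+-monoʳ-≤ (𝟙 (p i)) (rank≤cut p is incr t))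
                    (≤-reflexive (sym (cut-∷-above p i is t i<t))))

    rank≡cut-for-some : ∀ p is → Increasing is → ∃[ t ] rank p is ≡ cut p is t
    rank≡cut-for-some p []       _               = 0 , refl
    rank≡cut-for-some p (i ∷ is) (below ∷ incr) with ⊓-sel (countᵇ c (i ∷ is)) (𝟙 (p i) + rank p is)
    ... | inj₁ e = toℕ i , trans e (sym (cut-∷-below p i is (toℕ i) (≤⇒≤ᵇ≡true {toℕ i} ≤-refl) below))
    ... | inj₂ e with rank≡cut-for-some p is incr
    ...   | t , rank≡cut with ≡true⊎≡false (t ≤ᵇ toℕ i)
    ...     | inj₂ i<t = t , trans e (trans (cong (𝟙 (p i) +_) rank≡cut) (sym (cut-∷-above p i is t i<t)))
    ...     | inj₁ t≤i = suc (toℕ i) , (begin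
      rank p (i ∷ is)                   ≡⟨ e ⟩
      𝟙 (p i) + rank p is               ≡⟨ cong (𝟙 (p i) +_) rank≡cut ⟩
      𝟙 (p i) + cut p is t              ≡⟨ cong (𝟙 (p i) +_) (cut-lower-rows p (toℕ i) t is t≤1+i below) ⟩
      𝟙 (p i) + countᵇ c is             ≡⟨ cong (𝟙 (p i) +_) (cut-lower-rows p (toℕ i) (suc (toℕ i)) is ≤-refl below) ⟨
      𝟙 (p i) + cut p is (suc (toℕ i))  ≡⟨ cut-∷-above p i is (suc (toℕ i)) (>⇒≤ᵇ≡false {suc (toℕ i)} ≤-refl) ⟨
      cut p (i ∷ is) (suc (toℕ i))      ∎)
      where open ≡-Reasoning
            t≤1+i = m≤n⇒m≤1+n (≤ᵇ≡true⇒≤ t≤i)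

  allFin-increasing : ∀ {n} → Increasing (allFin n)
  allFin-increasing {n} = tabulate⁺-< {f = id} id

  module GreedyFilling {n : ℕ} (col : Fin n → Bool) where

    free : List (Fin n) → Fin n → Bool
    free occ i = col i ∧ not (member i occ)

    fits : Fin n → List (Fin n) → Fin n → Bool
    fits v occ i = col i ∧ (toℕ v ≤ᵇ toℕ i) ∧ not (member i occ)

    findBox-nothing : ∀ occ v is → findBox col occ v is ≡ nothing → All (λ i → fits v occ i ≡ false) is
    findBox-nothing occ v []       _  = []
    findBox-nothing occ v (i ∷ is) eq with fits v occ i in fits?
    ... | false = fits? ∷ findBox-nothing occ v is eq

    findBox-just : ∀ occ v is e → findBox col occ v is ≡ just e → Increasing is →
                   fits v occ e ≡ true × All (λ i → toℕ i < toℕ e → fits v occ i ≡ false) is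
    findBox-just occ v (i ∷ is) e eq (below ∷ incr) with fits v occ i in fits?
    ... | true with refl ← eq = fits? , ((λ i<i → ⊥-elim (<-irrefl refl i<i)) ∷
                                        All.map (λ i<j j<i → ⊥-elim (<-asym i<j j<i)) below)
    ... | false with findBox-just occ v is e eq incr
    ...   | fits-e , earlier = fits-e , ((λ _ → fits?) ∷ earlier)

    fits⇒free : ∀ v occ i → fits v occ i ≡ true → free occ i ≡ true × (toℕ v ≤ᵇ toℕ i) ≡ true
    fits⇒free v occ i fits-i with col i | toℕ v ≤ᵇ toℕ i | not (member i occ)
    ... | true | true | true = refl , refl

    ¬fits⇒¬free : ∀ v occ i → fits v occ i ≡ false → (toℕ v ≤ᵇ toℕ i) ≡ true → free occ i ≡ false
    ¬fits⇒¬free v occ i ¬fits v≤i rewrite v≤i with col i | not (member i occ)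
    ... | true  | false = refl
    ... | false | _     = refl

    free-∷⇒free : ∀ occ e i → free (e ∷ occ) i ≡ true → free occ i ≡ true
    free-∷⇒free occ e i h with col i | does (i ≟ e) | member i occ
    ... | true | false | false = refl

    belowCut : (Fin n → Bool) → List (Fin n) → ℕ → ℕ
    belowCut S L t = countᵇ (λ v → S v ∧ not (t ≤ᵇ toℕ v)) L

    freeFrom : List (Fin n) → ℕ → ℕ
    freeFrom occ t = countᵇ (λ i → free occ i ∧ (t ≤ᵇ toℕ i)) (allFin n)

    freeFrom-occupy : ∀ occ e t → free occ e ≡ true → freeFrom occ t ≡ freeFrom (e ∷ occ) t + 𝟙 (t ≤ᵇ toℕ e)
    freeFrom-occupy occ e t free-e = begin
      freeFrom occ t
        ≡⟨ ∑-cong split (allFin n) ⟩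
      ∑ (λ i → 𝟙 (free (e ∷ occ) i ∧ (t ≤ᵇ toℕ i)) + (if does (i ≟ e) then 𝟙 (t ≤ᵇ toℕ i) else 0)) (allFin n)
        ≡⟨ ∑-distrib-+ _ _ (allFin n) ⟩
      freeFrom (e ∷ occ) t + ∑ (λ i → if does (i ≟ e) then 𝟙 (t ≤ᵇ toℕ i) else 0) (allFin n)
        ≡⟨ cong (freeFrom (e ∷ occ) t +_) (∑-pick e (λ i → 𝟙 (t ≤ᵇ toℕ i))) ⟩
      freeFrom (e ∷ occ) t + 𝟙 (t ≤ᵇ toℕ e) ∎
      where
      open ≡-Reasoning
      split : ∀ i → 𝟙 (free occ i ∧ (t ≤ᵇ toℕ i)) ≡
                    𝟙 (free (e ∷ occ) i ∧ (t ≤ᵇ toℕ i)) + (if does (i ≟ e) then 𝟙 (t ≤ᵇ toℕ i) else 0)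
      split i with i ≟ e
      ... | yes refl rewrite free-e | ∧-zeroʳ (col i) = refl
      ... | no _     = sym (+-identityʳ _)

    belowCut-mono : ∀ S L {t₁ t₂} → t₁ ≤ t₂ → belowCut S L t₁ ≤ belowCut S L t₂
    belowCut-mono S L {t₁} {t₂} t₁≤t₂ = ∑-mono-≤ pointwise L
      where
      pointwise : ∀ v → 𝟙 (S v ∧ not (t₁ ≤ᵇ toℕ v)) ≤ 𝟙 (S v ∧ not (t₂ ≤ᵇ toℕ v))
      pointwise v with ≡true⊎≡false (t₂ ≤ᵇ toℕ v)
      ... | inj₁ t₂≤v rewrite t₂≤v | ≤⇒≤ᵇ≡true {t₁} {toℕ v} (≤-trans t₁≤t₂ (≤ᵇ≡true⇒≤ t₂≤v)) = ≤-refl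
      ... | inj₂ v<t₂ rewrite v<t₂ | ∧-identityʳ (S v) = 𝟙-∧ˡ (S v) (not (t₁ ≤ᵇ toℕ v))

    -- A placed value of S is either below the cut t or occupies a box that was free in a row ≥ t.
    placed≤cut : ∀ S occ L t → countᵇ S (fillCol col occ L) ≤ belowCut S L t + freeFrom occ t
    placed≤cut S occ []       t = z≤n
    placed≤cut S occ (v ∷ vs) t with findBox col occ v (allFin n) in found
    ... | nothing = ≤-trans (placed≤cut S occ vs t)
                      (+-monoˡ-≤ (freeFrom occ t) (m≤n+m (belowCut S vs t) (𝟙 (S v ∧ not (t ≤ᵇ toℕ v)))))
    ... | just e with fits⇒free v occ e (proj₁ (findBox-just occ v (allFin n) e found allFin-increasing))
    ...   | free-e , v≤e rewrite freeFrom-occupy occ e t free-e =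
      ≤-trans (+-mono-≤ (v-counted (S v)) (placed≤cut S (e ∷ occ) vs t)) (≤-reflexive
        (regroup (𝟙 (S v ∧ not (t ≤ᵇ toℕ v))) (𝟙 (t ≤ᵇ toℕ e)) (belowCut S vs t) (freeFrom (e ∷ occ) t)))
      where
      v-counted : ∀ s → 𝟙 s ≤ 𝟙 (s ∧ not (t ≤ᵇ toℕ v)) + 𝟙 (t ≤ᵇ toℕ e)
      v-counted false = z≤n
      v-counted true with ≡true⊎≡false (t ≤ᵇ toℕ v)
      ... | inj₁ t≤v rewrite t≤v | ≤⇒≤ᵇ≡true {t} {toℕ e} (≤-trans (≤ᵇ≡true⇒≤ t≤v) (≤ᵇ≡true⇒≤ v≤e)) = ≤-refl
      ... | inj₂ v<t rewrite v<t = s≤s z≤n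
      regroup : ∀ a b x y → (a + b) + (x + y) ≡ (a + x) + (y + b)
      regroup a b x y = trans (interchange a b x y) (cong ((a + x) +_) (+-comm b y))

    freeFrom-stuck : ∀ occ v → findBox col occ v (allFin n) ≡ nothing → freeFrom occ (toℕ v) ≡ 0
    freeFrom-stuck occ v stuck = ∑-zero none (allFin n)
      where
      none : ∀ i → 𝟙 (free occ i ∧ (toℕ v ≤ᵇ toℕ i)) ≡ 0
      none i with ≡true⊎≡false (toℕ v ≤ᵇ toℕ i)
      ... | inj₂ i<v rewrite i<v | ∧-zeroʳ (free occ i) = refl
      ... | inj₁ v≤i rewrite v≤i
          | ¬fits⇒¬free v occ i (All.lookup (findBox-nothing occ v (allFin n) stuck) (∈-allFin i)) v≤i = refl

    freeFrom-beyond : ∀ occ → freeFrom occ n ≡ 0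
    freeFrom-beyond occ = ∑-zero none (allFin n)
      where
      none : ∀ i → 𝟙 (free occ i ∧ (n ≤ᵇ toℕ i)) ≡ 0
      none i rewrite >⇒≤ᵇ≡false {n} {toℕ i} (toℕ<n i) | ∧-zeroʳ (free occ i) = refl

    -- Between v and the box e chosen for v, no box is free any more.
    freeFrom-flat : ∀ occ v e t → findBox col occ v (allFin n) ≡ just e → toℕ v ≤ t → t ≤ toℕ e →
                    freeFrom (e ∷ occ) (toℕ v) ≤ freeFrom (e ∷ occ) t
    freeFrom-flat occ v e t found v≤t t≤e = ∑-mono-≤ pointwise (allFin n)
      where
      earlier : All (λ i → toℕ i < toℕ e → fits v occ i ≡ false) (allFin n)
      earlier = proj₂ (findBox-just occ v (allFin n) e found allFin-increasing)
      pointwise : ∀ i → 𝟙 (free (e ∷ occ) i ∧ (toℕ v ≤ᵇ toℕ i)) ≤ 𝟙 (free (e ∷ occ) i ∧ (t ≤ᵇ toℕ i))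
      pointwise i with ≡true⊎≡false (t ≤ᵇ toℕ i) | ≡true⊎≡false (toℕ v ≤ᵇ toℕ i)
      ... | inj₁ t≤i | inj₁ v≤i rewrite t≤i | v≤i = ≤-refl
      ... | _        | inj₂ i<v rewrite i<v | ∧-zeroʳ (free (e ∷ occ) i) = z≤n
      ... | inj₂ i<t | inj₁ v≤i rewrite i<t | v≤i with ≡true⊎≡false (free (e ∷ occ) i)
      ...   | inj₂ ¬free rewrite ¬free = ≤-refl
      ...   | inj₁ free-i = ⊥-elim (true≢false (trans (sym (free-∷⇒free occ e i free-i))
                (¬fits⇒¬free v occ i (All.lookup earlier (∈-allFin i) (<-≤-trans (≤ᵇ≡false⇒> i<t) t≤e)) v≤i)))

    cutAll : List (Fin n) → List (Fin n) → ℕ → ℕ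
    cutAll occ L t = belowCut (λ _ → true) L t + freeFrom occ t

    cutAll-∷ : ∀ occ v vs t → cutAll occ (v ∷ vs) t ≡ 𝟙 (not (t ≤ᵇ toℕ v)) + cutAll occ vs t
    cutAll-∷ occ v vs t = +-assoc (𝟙 (not (t ≤ᵇ toℕ v))) (belowCut (λ _ → true) vs t) (freeFrom occ t)

    cutAll-occupy : ∀ occ v vs e t → free occ e ≡ true →
      cutAll occ (v ∷ vs) t ≡ cutAll (e ∷ occ) vs t + (𝟙 (not (t ≤ᵇ toℕ v)) + 𝟙 (t ≤ᵇ toℕ e))
    cutAll-occupy occ v vs e t free-e = begin
      cutAll occ (v ∷ vs) t                 ≡⟨ cutAll-∷ occ v vs t ⟩
      a + (b + freeFrom occ t)              ≡⟨ cong (λ x → a + (b + x)) (freeFrom-occupy occ e t free-e) ⟩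
      a + (b + (c + d))                     ≡⟨ cong (a +_) (+-assoc b c d) ⟨
      a + (b + c + d)                       ≡⟨ x∙yz≈y∙xz a (b + c) d ⟩
      b + c + (a + d)                       ∎
      where
      open ≡-Reasoning
      a = 𝟙 (not (t ≤ᵇ toℕ v))
      b = belowCut (λ _ → true) vs t
      c = freeFrom (e ∷ occ) t
      d = 𝟙 (t ≤ᵇ toℕ e)

    placed-∷-attained : ∀ occ v vs e t → free occ e ≡ true →
               countᵇ (λ _ → true) (fillCol col (e ∷ occ) vs) ≡ cutAll (e ∷ occ) vs t →
               𝟙 (not (t ≤ᵇ toℕ v)) + 𝟙 (t ≤ᵇ toℕ e) ≡ 1 →
               ∃[ t ] suc (countᵇ (λ _ → true) (fillCol col (e ∷ occ) vs)) ≡ cutAll occ (v ∷ vs) t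
    placed-∷-attained occ v vs e t free-e placed≡ one =
      t , trans (trans (+-comm 1 _) (cong₂ _+_ placed≡ (sym one))) (sym (cutAll-occupy occ v vs e t free-e))

    -- The converse of placed≤cut for S = everything: greedy placement is optimal.
    placed≡cut-for-some : ∀ occ L → ∃[ t ] countᵇ (λ _ → true) (fillCol col occ L) ≡ cutAll occ L t
    placed≡cut-for-some occ []       = n , sym (freeFrom-beyond occ)
    placed≡cut-for-some occ (v ∷ vs) with findBox col occ v (allFin n) in found
    ... | nothing with placed≡cut-for-some occ vs
    ...   | t , placed≡ with ≡true⊎≡false (t ≤ᵇ toℕ v)
    ...     | inj₁ t≤v = t , trans placed≡
                (sym (trans (cutAll-∷ occ v vs t) (cong (λ b → 𝟙 (not b) + cutAll occ vs t) t≤v)))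
    ...     | inj₂ v<t = toℕ v , trans (≤-antisym
                (placed≤cut (λ _ → true) occ vs (toℕ v))
                (≤-trans (+-mono-≤ (belowCut-mono (λ _ → true) vs v≤t)
                           (≤-trans (≤-reflexive (freeFrom-stuck occ v found)) z≤n))
                         (≤-reflexive (sym placed≡))))
              (sym (trans (cutAll-∷ occ v vs (toℕ v))
                          (cong (λ b → 𝟙 (not b) + cutAll occ vs (toℕ v)) (≤⇒≤ᵇ≡true {toℕ v} ≤-refl))))
      where v≤t = <⇒≤ (≤ᵇ≡false⇒> {t} {toℕ v} v<t)
    placed≡cut-for-some occ (v ∷ vs) | just e
      with fits⇒free v occ e (proj₁ (findBox-just occ v (allFin n) e found allFin-increasing))
         | placed≡cut-for-some (e ∷ occ) vs
    ...   | free-e , v≤e | t , placed≡ with ≡true⊎≡false (t ≤ᵇ toℕ v) | ≡true⊎≡false (t ≤ᵇ toℕ e)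
    ...     | inj₁ t≤v | _        = placed-∷-attained occ v vs e t free-e placed≡
              (cong₂ (λ a b → 𝟙 (not a) + 𝟙 b) t≤v
                (≤⇒≤ᵇ≡true {t} {toℕ e} (≤-trans (≤ᵇ≡true⇒≤ {t} t≤v) (≤ᵇ≡true⇒≤ {toℕ v} v≤e))))
    ...     | inj₂ v<t | inj₂ e<t = placed-∷-attained occ v vs e t free-e placed≡ (cong₂ (λ a b → 𝟙 (not a) + 𝟙 b) v<t e<t)
    ...     | inj₂ v<t | inj₁ t≤e = placed-∷-attained occ v vs e (toℕ v) free-e
              (≤-antisym (placed≤cut (λ _ → true) (e ∷ occ) vs (toℕ v))
                 (≤-trans (+-mono-≤ (belowCut-mono (λ _ → true) vs v≤t)
                                    (freeFrom-flat occ v e t found v≤t (≤ᵇ≡true⇒≤ t≤e)))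
                          (≤-reflexive (sym placed≡))))
              (cong₂ (λ a b → 𝟙 (not a) + 𝟙 b) (≤⇒≤ᵇ≡true {toℕ v} ≤-refl) v≤e)
      where v≤t = <⇒≤ (≤ᵇ≡false⇒> {t} {toℕ v} v<t)

    fillCol-⊆ : ∀ occ L → fillCol col occ L ⊆ L
    fillCol-⊆ occ []       = []
    fillCol-⊆ occ (v ∷ vs) with findBox col occ v (allFin n)
    ... | just i  = refl ∷ fillCol-⊆ (i ∷ occ) vs
    ... | nothing = v ∷ʳ fillCol-⊆ occ vs

    occupiedAfter : List (Fin n) → List (Fin n) → List (Fin n)
    occupiedAfter occ []       = occ
    occupiedAfter occ (v ∷ vs) with findBox col occ v (allFin n)
    ... | just i  = occupiedAfter (i ∷ occ) vs
    ... | nothing = occupiedAfter occ vs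

    fillCol-++ : ∀ occ A B → fillCol col occ (A ++ B) ≡ fillCol col occ A ++ fillCol col (occupiedAfter occ A) B
    fillCol-++ occ []       B = refl
    fillCol-++ occ (v ∷ vs) B with findBox col occ v (allFin n)
    ... | just i  = cong (v ∷_) (fillCol-++ (i ∷ occ) vs B)
    ... | nothing = fillCol-++ occ vs B

    freeFrom-[] : ∀ t → freeFrom [] t ≡ countᵇ (λ i → col i ∧ (t ≤ᵇ toℕ i)) (allFin n)
    freeFrom-[] t = ∑-cong (λ i → cong (λ b → 𝟙 (b ∧ (t ≤ᵇ toℕ i))) (∧-identityʳ (col i))) (allFin n)

    module _ (w : Permutation′ n) where
      open ColumnRank col

      countᵇ-filling≤rank : ∀ s → countᵇ s (fillCol col [] (oneLine w)) ≤ rank s (allFin n)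
      countᵇ-filling≤rank s with rank≡cut-for-some s (allFin n) allFin-increasing
      ... | t , rank≡cut = begin
        countᵇ s (fillCol col [] (oneLine w))    ≤⟨ placed≤cut s [] (oneLine w) t ⟩
        belowCut s (oneLine w) t + freeFrom [] t ≡⟨ cong₂ _+_ (∑-oneLine w _) (freeFrom-[] t) ⟩
        cut s (allFin n) t                       ≡⟨ rank≡cut ⟨
        rank s (allFin n)                        ∎
        where open ≤-Reasoning

      cutAll-prefix≡cut : ∀ k t → cutAll [] (take k (oneLine w)) t ≡ cut (prefix w k) (allFin n) t
      cutAll-prefix≡cut k t = cong₂ _+_ (begin
        countᵇ (λ v → not (t ≤ᵇ toℕ v)) A ≡⟨ ∑-congᴬ (All.map in-A (prefix-take w k)) ⟩
        countᵇ P<t A                      ≡⟨ +-identityʳ _ ⟨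
        countᵇ P<t A + 0                  ≡⟨ cong (countᵇ P<t A +_) (countᵇ-none (All.map in-B (prefix-drop w k))) ⟨
        countᵇ P<t A + countᵇ P<t B       ≡⟨ ∑-++ _ A B ⟨
        countᵇ P<t (A ++ B)               ≡⟨ cong (countᵇ P<t) (take++drop≡id k (oneLine w)) ⟩
        countᵇ P<t (oneLine w)            ≡⟨ ∑-oneLine w _ ⟩
        countᵇ P<t (allFin n)             ∎) (freeFrom-[] t)
        where
        open ≡-Reasoning
        A = take k (oneLine w)
        B = drop k (oneLine w)
        P<t : Fin n → Bool
        P<t i = prefix w k i ∧ not (t ≤ᵇ toℕ i)
        in-A : ∀ {v} → prefix w k v ≡ true → 𝟙 (not (t ≤ᵇ toℕ v)) ≡ 𝟙 (P<t v)
        in-A {v} Pv = cong (λ b → 𝟙 (b ∧ not (t ≤ᵇ toℕ v))) (sym Pv)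
        in-B : ∀ {v} → prefix w k v ≡ false → P<t v ≡ false
        in-B {v} Pv = cong (λ b → b ∧ not (t ≤ᵇ toℕ v)) Pv

      -- Both sides are the minimum of the same family of cuts.
      placed-prefix≡rank : ∀ k → countᵇ (λ _ → true) (fillCol col [] (take k (oneLine w))) ≡ rank (prefix w k) (allFin n)
      placed-prefix≡rank k with rank≡cut-for-some (prefix w k) (allFin n) allFin-increasing
                             | placed≡cut-for-some [] (take k (oneLine w))
      ... | t , rank≡cut | t′ , placed≡cut = ≤-antisym
        (≤-trans (placed≤cut (λ _ → true) [] (take k (oneLine w)) t)
                 (≤-reflexive (trans (cutAll-prefix≡cut k t) (sym rank≡cut))))
        (≤-trans (rank≤cut (prefix w k) (allFin n) allFin-increasing t′)
                 (≤-reflexive (sym (trans placed≡cut (cutAll-prefix≡cut k t′)))))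

      -- The first k values of w are placed as if they were alone, and later values never belong to the prefix.
      countᵇ-filling-prefix : ∀ k → countᵇ (prefix w k) (fillCol col [] (oneLine w)) ≡ rank (prefix w k) (allFin n)
      countᵇ-filling-prefix k = begin
        countᵇ P (fillCol col [] (oneLine w))
          ≡⟨ cong (countᵇ P ∘ fillCol col []) (take++drop≡id k (oneLine w)) ⟨
        countᵇ P (fillCol col [] (A ++ B))
          ≡⟨ cong (countᵇ P) (fillCol-++ [] A B) ⟩
        countᵇ P (fillCol col [] A ++ fillCol col (occupiedAfter [] A) B)
          ≡⟨ ∑-++ _ (fillCol col [] A) _ ⟩
        countᵇ P (fillCol col [] A) + countᵇ P (fillCol col (occupiedAfter [] A) B)
          ≡⟨ cong₂ _+_ (countᵇ-every (All-resp-⊆ (fillCol-⊆ [] A) (prefix-take w k)))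
                       (countᵇ-none (All-resp-⊆ (fillCol-⊆ _ B) (prefix-drop w k))) ⟩
        countᵇ (λ _ → true) (fillCol col [] A) + 0
          ≡⟨ +-identityʳ _ ⟩
        countᵇ (λ _ → true) (fillCol col [] A)
          ≡⟨ placed-prefix≡rank k ⟩
        rank P (allFin n) ∎
        where
        open ≡-Reasoning
        A = take k (oneLine w)
        B = drop k (oneLine w)
        P = prefix w k

  ∑-count≡countᵇ : ∀ {n} (s : Fin n → Bool) xs → ∑ (λ i → if s i then count i xs else 0) (allFin n) ≡ countᵇ s xs
  ∑-count≡countᵇ {n} s []       = ∑-zero (λ i → if-0 (s i)) (allFin n)
    where
    if-0 : ∀ b → (if b then 0 else 0) ≡ 0
    if-0 true  = refl
    if-0 false = refl
  ∑-count≡countᵇ {n} s (v ∷ vs) = begin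
    ∑ (λ i → if s i then count i (v ∷ vs) else 0) (allFin n)
      ≡⟨ ∑-cong split (allFin n) ⟩
    ∑ (λ i → (if does (i ≟ v) then 𝟙 (s i) else 0) + (if s i then count i vs else 0)) (allFin n)
      ≡⟨ ∑-distrib-+ _ _ (allFin n) ⟩
    ∑ (λ i → if does (i ≟ v) then 𝟙 (s i) else 0) (allFin n) + ∑ (λ i → if s i then count i vs else 0) (allFin n)
      ≡⟨ cong₂ _+_ (∑-pick v (λ i → 𝟙 (s i))) (∑-count≡countᵇ s vs) ⟩
    𝟙 (s v) + countᵇ s vs ∎
    where
    open ≡-Reasoning
    split : ∀ i → (if s i then count i (v ∷ vs) else 0) ≡
                  (if does (i ≟ v) then 𝟙 (s i) else 0) + (if s i then count i vs else 0)
    split i with s i | does (i ≟ v)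
    ... | true  | true  = refl
    ... | true  | false = refl
    ... | false | true  = refl
    ... | false | false = refl

  module _ {n : ℕ} (D : Diagram n) where

    column : Fin n → Fin n → Bool
    column j i = D i j

    θᵇ : (Fin n → Bool) → ℕ
    θᵇ p = ∑ (λ j → ColumnRank.rank (column j) p (allFin n)) (allFin n)

    θ≡θᵇ : ∀ S → θ D S ≡ θᵇ (lookup S)
    θ≡θᵇ S = trans (sum-map≡∑ _ (allFin n))
                   (∑-cong (λ j → ColumnRank.pairs+stars≡rank (column j) (lookup S) (allFin n)) (allFin n))

    θᵇ-cong : ∀ {p q} → (∀ i → p i ≡ q i) → θᵇ p ≡ θᵇ q
    θᵇ-cong p≗q = ∑-cong (λ j → ColumnRank.rank-cong (column j) p≗q (allFin n)) (allFin n)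

    θᵇ-submodular : ∀ p q → θᵇ (λ i → p i ∨ q i) + θᵇ (λ i → p i ∧ q i) ≤ θᵇ p + θᵇ q
    θᵇ-submodular p q = begin
      θᵇ (λ i → p i ∨ q i) + θᵇ (λ i → p i ∧ q i)
        ≡⟨ ∑-distrib-+ (λ j → rank j (λ i → p i ∨ q i)) (λ j → rank j (λ i → p i ∧ q i)) (allFin n) ⟨
      ∑ (λ j → rank j (λ i → p i ∨ q i) + rank j (λ i → p i ∧ q i)) (allFin n)
        ≤⟨ ∑-mono-≤ (λ j → ColumnRank.rank-submodular (column j) p q (allFin n)) (allFin n) ⟩
      ∑ (λ j → rank j p + rank j q) (allFin n)
        ≡⟨ ∑-distrib-+ (λ j → rank j p) (λ j → rank j q) (allFin n) ⟩
      θᵇ p + θᵇ q ∎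
      where
      open ≤-Reasoning
      rank : Fin n → (Fin n → Bool) → ℕ
      rank j p = ColumnRank.rank (column j) p (allFin n)

    θᵇ-none : θᵇ (λ _ → false) ≡ 0
    θᵇ-none = ∑-zero (λ j → ColumnRank.rank-none (column j) (allFin n)) (allFin n)

    θᵇ-all : θᵇ (λ _ → true) ≡ size D
    θᵇ-all = begin
      θᵇ (λ _ → true)                                       ≡⟨ ∑-cong (λ j → ColumnRank.rank-all (column j) (allFin n)) (allFin n) ⟩
      ∑ (λ j → ∑ (λ i → 𝟙 (D i j)) (allFin n)) (allFin n)   ≡⟨ ∑-comm (λ i j → 𝟙 (D i j)) (allFin n) (allFin n) ⟨
      ∑ (λ i → ∑ (λ j → 𝟙 (D i j)) (allFin n)) (allFin n)
        ≡⟨ ∑-cong (λ i → ∑-cong (λ j → if-1-0≡𝟙 (D i j)) (allFin n)) (allFin n) ⟨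
      ∑ (λ i → ∑ (λ j → if D i j then 1 else 0) (allFin n)) (allFin n)
        ≡⟨ trans (sum-map≡∑ _ (allFin n)) (∑-cong (λ i → sum-map≡∑ _ (allFin n)) (allFin n)) ⟨
      size D                                                ∎
      where
      open ≡-Reasoning
      if-1-0≡𝟙 : ∀ b → (if b then 1 else 0) ≡ 𝟙 b
      if-1-0≡𝟙 true  = refl
      if-1-0≡𝟙 false = refl

    filling : Permutation′ n → Fin n → List (Fin n)
    filling w j = fillCol (column j) [] (oneLine w)

    ∑-xw : ∀ w s → ∑ (λ i → if s i then xw D w i else 0) (allFin n) ≡ ∑ (λ j → countᵇ s (filling w j)) (allFin n)
    ∑-xw w s = begin
      ∑ (λ i → if s i then xw D w i else 0) (allFin n)
        ≡⟨ ∑-cong by-column (allFin n) ⟩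
      ∑ (λ i → ∑ (λ j → if s i then count i (filling w j) else 0) (allFin n)) (allFin n)
        ≡⟨ ∑-comm (λ i j → if s i then count i (filling w j) else 0) (allFin n) (allFin n) ⟩
      ∑ (λ j → ∑ (λ i → if s i then count i (filling w j) else 0) (allFin n)) (allFin n)
        ≡⟨ ∑-cong (λ j → ∑-count≡countᵇ s (filling w j)) (allFin n) ⟩
      ∑ (λ j → countᵇ s (filling w j)) (allFin n) ∎
      where
      open ≡-Reasoning
      by-column : ∀ i → (if s i then xw D w i else 0) ≡ ∑ (λ j → if s i then count i (filling w j) else 0) (allFin n)
      by-column i with s i
      ... | true  = sum-map≡∑ _ (allFin n)
      ... | false = sym (∑-zero (λ _ → refl) (allFin n))

    xw-≤θᵇ : ∀ w s → ∑ (λ i → if s i then xw D w i else 0) (allFin n) ≤ θᵇ s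
    xw-≤θᵇ w s = ≤-trans (≤-reflexive (∑-xw w s))
                         (∑-mono-≤ (λ j → GreedyFilling.countᵇ-filling≤rank (column j) w s) (allFin n))

    xw-prefix≡θᵇ : ∀ w k → ∑ (λ i → if prefix w k i then xw D w i else 0) (allFin n) ≡ θᵇ (prefix w k)
    xw-prefix≡θᵇ w k = trans (∑-xw w (prefix w k))
                             (∑-cong (λ j → GreedyFilling.countᵇ-filling-prefix (column j) w k) (allFin n))

  countᵇ-⊂ : ∀ {n} (p q : Fin n → Bool) j → (∀ y → p y ≡ true → q y ≡ true) → p j ≡ false → q j ≡ true →
             countᵇ p (allFin n) < countᵇ q (allFin n)
  countᵇ-⊂ {n} p q j p⊆q ¬pj qj = begin-strict
    countᵇ p (allFin n)                                                    <⟨ n<1+n _ ⟩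
    suc (countᵇ p (allFin n))                                              ≡⟨ +-comm 1 _ ⟩
    countᵇ p (allFin n) + 1                                                ≡⟨ cong (countᵇ p (allFin n) +_) (∑-pick j (λ _ → 1)) ⟨
    countᵇ p (allFin n) + ∑ (λ y → if does (y ≟ j) then 1 else 0) (allFin n) ≡⟨ ∑-distrib-+ _ _ (allFin n) ⟨
    ∑ (λ y → 𝟙 (p y) + (if does (y ≟ j) then 1 else 0)) (allFin n)          ≤⟨ ∑-mono-≤ pointwise (allFin n) ⟩
    countᵇ q (allFin n)                                                    ∎
    where
    open ≤-Reasoning
    pointwise : ∀ y → 𝟙 (p y) + (if does (y ≟ j) then 1 else 0) ≤ 𝟙 (q y)
    pointwise y with y ≟ j
    ... | yes refl rewrite ¬pj | qj = ≤-refl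
    ... | no _ with ≡true⊎≡false (p y)
    ...   | inj₁ py rewrite py | p⊆q y py = ≤-refl
    ...   | inj₂ py rewrite py = z≤n

  <ᵇ-suc-≢ : ∀ {a b} → a ≢ b → (a <ᵇ suc b) ≡ (a <ᵇ b)
  <ᵇ-suc-≢ {a} {b} a≢b with <-cmp a b
  ... | tri< a<b _ _ = trans (<⇒<ᵇ≡true (m<n⇒m<1+n a<b)) (sym (<⇒<ᵇ≡true a<b))
  ... | tri≈ _ a≡b _ = ⊥-elim (a≢b a≡b)
  ... | tri> _ _ b<a = trans (≥⇒<ᵇ≡false b<a) (sym (≥⇒<ᵇ≡false (<⇒≤ b<a)))

  module _ {n : ℕ} (a m : Fin n) (a≤m : toℕ a ≤ toℕ m) where

    transpose-<ᵇ-≤ : ∀ q k → k ≤ toℕ a → (toℕ (PC.transpose m a q) <ᵇ k) ≡ (toℕ q <ᵇ k)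
    transpose-<ᵇ-≤ q k k≤a with q ≟ m
    ... | yes refl = trans (≥⇒<ᵇ≡false k≤a) (sym (≥⇒<ᵇ≡false (≤-trans k≤a a≤m)))
    ... | no _ with q ≟ a
    ...   | yes refl = trans (≥⇒<ᵇ≡false (≤-trans k≤a a≤m)) (sym (≥⇒<ᵇ≡false k≤a))
    ...   | no _     = refl

    transpose-<ᵇ-suc : ∀ q → (toℕ (PC.transpose m a q) <ᵇ suc (toℕ a)) ≡ ((toℕ q <ᵇ toℕ a) ∨ does (q ≟ m))
    transpose-<ᵇ-suc q with q ≟ m
    ... | yes refl = trans (<⇒<ᵇ≡true {toℕ a} ≤-refl) (sym (∨-zeroʳ _))
    ... | no q≢m with q ≟ a
    ...   | yes refl = trans (≥⇒<ᵇ≡false (≤∧≢⇒< a≤m (q≢m ∘ toℕ-injective)))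
                             (sym (trans (∨-identityʳ _) (≥⇒<ᵇ≡false {toℕ q} ≤-refl)))
    ...   | no q≢a   = trans (<ᵇ-suc-≢ (q≢a ∘ toℕ-injective)) (sym (∨-identityʳ _))

  ≗-∪-singleton : ∀ {n} (P Q : Fin n → Bool) i → (∀ y → P y ≡ true → Q y ≡ true) → Q i ≡ true →
                  ¬ (∃[ j ] Q j ≡ true × (P j ∨ does (j ≟ i)) ≡ false) → ∀ y → Q y ≡ (P y ∨ does (y ≟ i))
  ≗-∪-singleton P Q i P⊆Q Qi ∄j y with ≡true⊎≡false (Q y) | ≡true⊎≡false (P y ∨ does (y ≟ i))
  ... | inj₁ Qy | inj₁ P∪i-y = trans Qy (sym P∪i-y)
  ... | inj₂ Qy | inj₂ P∪i-y = trans Qy (sym P∪i-y)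
  ... | inj₁ Qy | inj₂ P∪i-y = ⊥-elim (∄j (y , Qy , P∪i-y))
  ... | inj₂ Qy | inj₁ P∪i-y = ⊥-elim (true≢false (trans (sym (P∪i⊆Q P∪i-y)) Qy))
    where
    P∪i⊆Q : (P y ∨ does (y ≟ i)) ≡ true → Q y ≡ true
    P∪i⊆Q P∪i-y with y ≟ i
    ... | yes refl = Qi
    ... | no _     = P⊆Q y (trans (sym (∨-identityʳ (P y))) P∪i-y)

  module TightChain {n : ℕ} (Tight : (Fin n → Bool) → Set)
    (Tight-cong : ∀ {p q} → (∀ i → p i ≡ q i) → Tight p → Tight q)
    (Tight-∨ : ∀ {p q} → Tight p → Tight q → Tight (λ i → p i ∨ q i))
    (Tight-∧ : ∀ {p q} → Tight p → Tight q → Tight (λ i → p i ∧ q i))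
    (Tight-none : Tight (λ _ → false))
    (Tight-all : Tight (λ _ → true))
    (separating : ∀ i j → i ≢ j → ∃[ S ] Tight S × S i ≢ S j)
    where

    -- Descent on |Q|: a tight set separating i from another j ∈ Q ∖ P cuts Q down to a smaller tight set.
    tight-extension : ∀ {P} → Tight P → ∀ m Q i → countᵇ Q (allFin n) < m → Tight Q →
                      (∀ y → P y ≡ true → Q y ≡ true) → Q i ≡ true → P i ≡ false →
                      ∃[ e ] P e ≡ false × Tight (λ y → P y ∨ does (y ≟ e))
    tight-extension {P} tP (suc m) Q i |Q|<1+m tQ P⊆Q Qi ¬Pi
      with any? (λ j → (Q j Boolₚ.≟ true) ×-dec ((P j ∨ does (j ≟ i)) Boolₚ.≟ false))
    ... | no ∄j = i , ¬Pi , Tight-cong (≗-∪-singleton P Q i P⊆Q Qi ∄j) tQ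
    ... | yes (j , Qj , j∉P∪i) with separating i j i≢j
      where
      i≢j : i ≢ j
      i≢j i≡j = true≢false (trans (sym (dec-true (j ≟ i) (sym i≡j))) (∨-conicalʳ (P j) _ j∉P∪i))
    ...   | S , tS , Si≢Sj = orient (≡true⊎≡false (S i))
      where
      ¬Pj : P j ≡ false
      ¬Pj = ∨-conicalˡ (P j) _ j∉P∪i
      Sj≡not-Si : S j ≡ not (S i)
      Sj≡not-Si = Boolₚ.¬-not (Si≢Sj ∘ sym)
      Q′ : Fin n → Bool
      Q′ y = (S y ∨ P y) ∧ Q y
      P⊆Q′ : ∀ y → P y ≡ true → Q′ y ≡ true
      P⊆Q′ y Py rewrite Py | ∨-zeroʳ (S y) = P⊆Q y Py
      Q′⊆Q : ∀ y → Q′ y ≡ true → Q y ≡ true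
      Q′⊆Q y Q′y with S y ∨ P y
      ... | true = Q′y
      keeps : ∀ x → S x ≡ true → Q x ≡ true → Q′ x ≡ true
      keeps x Sx Qx rewrite Sx = Qx
      drops : ∀ x → S x ≡ false → P x ≡ false → Q′ x ≡ false
      drops x Sx ¬Px rewrite Sx | ¬Px = refl
      recurse : ∀ x x′ → Q′ x ≡ true → Q′ x′ ≡ false → Q x′ ≡ true → P x ≡ false →
                ∃[ e ] P e ≡ false × Tight (λ y → P y ∨ does (y ≟ e))
      recurse x x′ Q′x ¬Q′x′ Qx′ ¬Px =
        tight-extension tP m Q′ x (<-≤-trans (countᵇ-⊂ Q′ Q x′ Q′⊆Q ¬Q′x′ Qx′) (≤-pred |Q|<1+m))
                        (Tight-∧ (Tight-∨ tS tP) tQ) P⊆Q′ Q′x ¬Px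
      orient : S i ≡ true ⊎ S i ≡ false → ∃[ e ] P e ≡ false × Tight (λ y → P y ∨ does (y ≟ e))
      orient (inj₁ Si) = recurse i j (keeps i Si Qi) (drops j (trans Sj≡not-Si (cong not Si)) ¬Pj) Qj ¬Pi
      orient (inj₂ Si) = recurse j i (keeps j (trans Sj≡not-Si (cong not Si)) Qj) (drops i Si ¬Pi) Qi ¬Pj

    extend-prefix : ∀ (w : Permutation′ n) k → k < n → Tight (prefix w k) →
                    ∃[ e ] prefix w k e ≡ false × Tight (λ y → prefix w k y ∨ does (y ≟ e))
    extend-prefix w k k<n tP =
      tight-extension tP (suc (countᵇ (λ _ → true) (allFin n))) (λ _ → true) (w ⟨$⟩ʳ fromℕ< k<n) ≤-refl
                      Tight-all (λ _ _ → refl) refl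
                      (trans (prefix-⟨$⟩ʳ w k (fromℕ< k<n)) (trans (cong (_<ᵇ k) (toℕ-fromℕ< k<n)) (≥⇒<ᵇ≡false {k} ≤-refl)))

    -- Extending the k-th prefix by e amounts to swapping positions k and w⁻¹(e) of w.
    tight-prefixes : ∀ k → k ≤ n → ∃[ w ] (∀ k′ → k′ ≤ k → Tight (prefix w k′))
    tight-prefixes zero    _   = Perm.id , λ { zero _ → Tight-none }
    tight-prefixes (suc k) k<n with tight-prefixes k (<⇒≤ k<n)
    ... | w , tight with extend-prefix w k k<n (tight k ≤-refl)
    ...   | e , ¬Pe , tPe = Perm.transpose a m ∘ₚ w , tight′
      where
      a = fromℕ< k<n
      m = w ⟨$⟩ˡ e
      toℕa≡k : toℕ a ≡ k
      toℕa≡k = toℕ-fromℕ< k<n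
      a≤m : toℕ a ≤ toℕ m
      a≤m = subst (_≤ toℕ m) (sym toℕa≡k) (≮⇒≥ (λ m<k → true≢false (trans (sym (<⇒<ᵇ≡true m<k)) ¬Pe)))
      same-e : ∀ y → does ((w ⟨$⟩ˡ y) ≟ m) ≡ does (y ≟ e)
      same-e y = does-⇔ (mk⇔ (λ eq → trans (sym (inverseʳ w)) (trans (cong (w ⟨$⟩ʳ_) eq) (inverseʳ w)))
                             (cong (w ⟨$⟩ˡ_))) ((w ⟨$⟩ˡ y) ≟ m) (y ≟ e)
      tight′ : ∀ k′ → k′ ≤ suc k → Tight (prefix (Perm.transpose a m ∘ₚ w) k′)
      tight′ k′ k′≤1+k with m≤n⇒m<n∨m≡n k′≤1+k
      ... | inj₁ (s≤s k′≤k) = Tight-cong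
            (λ y → sym (transpose-<ᵇ-≤ a m a≤m (w ⟨$⟩ˡ y) k′ (subst (k′ ≤_) (sym toℕa≡k) k′≤k)))
            (tight k′ k′≤k)
      ... | inj₂ refl = Tight-cong (λ y → sym (begin
            toℕ (PC.transpose m a (w ⟨$⟩ˡ y)) <ᵇ suc k
              ≡⟨ cong (λ k → toℕ (PC.transpose m a (w ⟨$⟩ˡ y)) <ᵇ suc k) toℕa≡k ⟨
            toℕ (PC.transpose m a (w ⟨$⟩ˡ y)) <ᵇ suc (toℕ a)
              ≡⟨ transpose-<ᵇ-suc a m a≤m (w ⟨$⟩ˡ y) ⟩
            (toℕ (w ⟨$⟩ˡ y) <ᵇ toℕ a) ∨ does ((w ⟨$⟩ˡ y) ≟ m)
              ≡⟨ cong₂ _∨_ (cong (toℕ (w ⟨$⟩ˡ y) <ᵇ_) toℕa≡k) (same-e y) ⟩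
            prefix w k y ∨ does (y ≟ e) ∎)) tPe
        where open ≡-Reasoning

    tight-chain : ∃[ w ] (∀ k → Tight (prefix w k))
    tight-chain with tight-prefixes n ≤-refl
    ... | w , tight = w , all-k
      where
      all-k : ∀ k → Tight (prefix w k)
      all-k k with k ≤? n
      ... | yes k≤n = tight k k≤n
      ... | no  k≰n = Tight-cong (λ i → trans (<⇒<ᵇ≡true (toℕ<n (w ⟨$⟩ˡ i)))
                                               (sym (<⇒<ᵇ≡true (<-trans (toℕ<n (w ⟨$⟩ˡ i)) (≰⇒> k≰n)))))
                                 (tight n ≤-refl)

module Geometry where

  open import Data.Nat as ℕ using (ℕ; zero; suc)
  import Data.Nat.Properties as ℕₚ
  import Data.Integer as ℤ
  import Data.Integer.Properties as ℤₚ
  import Data.Nat.Coprimality as Coprimality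
  open import Data.Rational using (ℚ; mkℚ; 0ℚ; 1ℚ; ½; _+_; _*_; _-_; -_; _≤_; _<_; _⊓_; *≤*; *<*; positive)
  open import Data.Rational.Properties hiding (_≟_)
  open import Data.Rational.Properties using () renaming (_≟_ to _≟ℚ_)
  open import Data.Fin.Properties using (all?; toℕ-injective; toℕ<n)
  open import Data.Fin.Subset using (Subset; ⊤)
  open import Relation.Binary.Definitions using (tri<; tri≈; tri>)
  open import Relation.Nullary using (¬?)
  open import Relation.Nullary.Decidable using (decidable-stable)
  open import Data.Fin.Subset.Properties using (anySubset?)
  import Data.Vec as Vec
  open import Data.Vec.Properties using (lookup∘tabulate; lookup-replicate)
  open import Data.Rational.Solver using (module +-*-Solver)
  open import Algebra.Properties.Group +-0-group using (∙-cancelˡ; ⁻¹-involutive)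
  open import Algebra.Bundles using (CommutativeMonoid)
  open import Algebra.Properties.CommutativeSemigroup (CommutativeMonoid.commutativeSemigroup +-0-commutativeMonoid)
    using (interchange)
  open Combinatorics
    using ( ∑; prefix; prefix-⟨$⟩ʳ; <⇒<ᵇ≡true; ≥⇒<ᵇ≡false; <ᵇ-suc-≢; module TightChain
          ; θᵇ; θ≡θᵇ; θᵇ-cong; θᵇ-all; θᵇ-none; θᵇ-submodular; xw-≤θᵇ; xw-prefix≡θᵇ )

  toℚ-mkℚ : ∀ k → toℚ k ≡ mkℚ (ℤ.+ k) 0 (Coprimality.sym (Coprimality.1-coprimeTo k))
  toℚ-mkℚ k = normalize-coprime _

  toℚ-+ : ∀ a b → toℚ (a ℕ.+ b) ≡ toℚ a + toℚ b
  toℚ-+ a b rewrite toℚ-mkℚ a | toℚ-mkℚ b | ℕₚ.*-identityʳ a | ℕₚ.*-identityʳ b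
                  | ℤₚ.◃-inverse (ℤ.+ a) | ℤₚ.◃-inverse (ℤ.+ b) =
    cong (λ z → Data.Rational._/_ z 1) (ℤₚ.pos-+ a b)

  toℚ-mono-≤ : ∀ {a b} → a ℕ.≤ b → toℚ a ≤ toℚ b
  toℚ-mono-≤ {a} {b} a≤b rewrite toℚ-mkℚ a | toℚ-mkℚ b = *≤* (ℤₚ.*-monoʳ-≤-nonNeg (ℤ.+ 1) (ℤ.+≤+ a≤b))

  module _ {A : Set} where

    sumℚ-cong : {f g : A → ℚ} → (∀ x → f x ≡ g x) → ∀ xs → sumℚ f xs ≡ sumℚ g xs
    sumℚ-cong f≗g []       = refl
    sumℚ-cong f≗g (x ∷ xs) = cong₂ _+_ (f≗g x) (sumℚ-cong f≗g xs)

    sumℚ-zero : {f : A → ℚ} → (∀ x → f x ≡ 0ℚ) → ∀ xs → sumℚ f xs ≡ 0ℚ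
    sumℚ-zero f≗0 []       = refl
    sumℚ-zero f≗0 (x ∷ xs) rewrite f≗0 x | sumℚ-zero f≗0 xs = refl

    sumℚ-distrib-+ : (f g : A → ℚ) → ∀ xs → sumℚ (λ x → f x + g x) xs ≡ sumℚ f xs + sumℚ g xs
    sumℚ-distrib-+ f g []       = refl
    sumℚ-distrib-+ f g (x ∷ xs) =
      trans (cong (f x + g x +_) (sumℚ-distrib-+ f g xs)) (interchange (f x) (g x) (sumℚ f xs) (sumℚ g xs))

    sumℚ-*ˡ : (t : ℚ) (f : A → ℚ) → ∀ xs → sumℚ (λ x → t * f x) xs ≡ t * sumℚ f xs
    sumℚ-*ˡ t f []       = sym (*-zeroʳ t)
    sumℚ-*ˡ t f (x ∷ xs) rewrite sumℚ-*ˡ t f xs = sym (*-distribˡ-+ t (f x) (sumℚ f xs))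

    sumℚ-toℚ : (f : A → ℕ) → ∀ xs → sumℚ (λ x → toℚ (f x)) xs ≡ toℚ (∑ f xs)
    sumℚ-toℚ f []       = refl
    sumℚ-toℚ f (x ∷ xs) rewrite sumℚ-toℚ f xs = sym (toℚ-+ (f x) (∑ f xs))

  sumℚ-tabulate : ∀ {A : Set} {n} (f : A → ℚ) (g : Fin n → A) → sumℚ f (tabulate g) ≡ sumℚ (f ∘ g) (allFin n)
  sumℚ-tabulate {n = zero}  f g = refl
  sumℚ-tabulate {n = suc n} f g =
    cong (f (g fzero) +_) (trans (sumℚ-tabulate f (g ∘ fsuc)) (sym (sumℚ-tabulate (f ∘ g) fsuc)))

  sumℚ-pick : ∀ {n} (e : Fin n) (f : Fin n → ℚ) → sumℚ (λ i → if does (i ≟ e) then f i else 0ℚ) (allFin n) ≡ f e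
  sumℚ-pick {suc n} fzero    f = begin
    f fzero + sumℚ δ (tabulate fsuc)     ≡⟨ cong (f fzero +_) (sumℚ-tabulate δ fsuc) ⟩
    f fzero + sumℚ (δ ∘ fsuc) (allFin n) ≡⟨ cong (f fzero +_) (sumℚ-zero (λ _ → refl) (allFin n)) ⟩
    f fzero + 0ℚ                         ≡⟨ +-identityʳ (f fzero) ⟩
    f fzero                              ∎
    where open ≡-Reasoning
          δ = λ i → if does (i ≟ fzero) then f i else 0ℚ
  sumℚ-pick {suc n} (fsuc e) f =
    trans (+-identityˡ _) (trans (sumℚ-tabulate (λ i → if does (i ≟ fsuc e) then f i else 0ℚ) fsuc)
                                 (sumℚ-pick e (f ∘ fsuc)))

  module _ {n : ℕ} where

    sumOn : (Fin n → Bool) → (Fin n → ℚ) → ℚ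
    sumOn p x = sumℚ (λ i → if p i then x i else 0ℚ) (allFin n)

    sumOn-cong : ∀ {p q : Fin n → Bool} {x y : Fin n → ℚ} → (∀ i → p i ≡ q i) → (∀ i → x i ≡ y i) →
                 sumOn p x ≡ sumOn q y
    sumOn-cong p≗q x≗y = sumℚ-cong (λ i → cong₂ (λ b v → if b then v else 0ℚ) (p≗q i) (x≗y i)) (allFin n)

    sumOn-+ : ∀ p (x y : Fin n → ℚ) → sumOn p (λ i → x i + y i) ≡ sumOn p x + sumOn p y
    sumOn-+ p x y = trans (sumℚ-cong split (allFin n))
                          (sumℚ-distrib-+ (λ i → if p i then x i else 0ℚ) (λ i → if p i then y i else 0ℚ) (allFin n))
      where
      split : ∀ i → (if p i then x i + y i else 0ℚ) ≡ (if p i then x i else 0ℚ) + (if p i then y i else 0ℚ)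
      split i with p i
      ... | true  = refl
      ... | false = refl

    sumOn-*ˡ : ∀ p (t : ℚ) (x : Fin n → ℚ) → sumOn p (λ i → t * x i) ≡ t * sumOn p x
    sumOn-*ˡ p t x = trans (sumℚ-cong pull (allFin n)) (sumℚ-*ˡ t _ (allFin n))
      where
      pull : ∀ i → (if p i then t * x i else 0ℚ) ≡ t * (if p i then x i else 0ℚ)
      pull i with p i
      ... | true  = refl
      ... | false = sym (*-zeroʳ t)

    sumOn-pick : ∀ p (e : Fin n) (c : ℚ) → sumOn p (λ k → if does (k ≟ e) then c else 0ℚ) ≡ (if p e then c else 0ℚ)
    sumOn-pick p e c = trans (sumℚ-cong swap (allFin n)) (sumℚ-pick e (λ i → if p i then c else 0ℚ))
      where
      swap : ∀ i → (if p i then (if does (i ≟ e) then c else 0ℚ) else 0ℚ) ≡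
                   (if does (i ≟ e) then (if p i then c else 0ℚ) else 0ℚ)
      swap i with p i | does (i ≟ e)
      ... | true  | true  = refl
      ... | true  | false = refl
      ... | false | true  = refl
      ... | false | false = refl

    sumOn-∨+sumOn-∧ : ∀ p q (x : Fin n → ℚ) →
                      sumOn (λ i → p i ∨ q i) x + sumOn (λ i → p i ∧ q i) x ≡ sumOn p x + sumOn q x
    sumOn-∨+sumOn-∧ p q x = begin
      sumOn (λ i → p i ∨ q i) x + sumOn (λ i → p i ∧ q i) x
        ≡⟨ sumℚ-distrib-+ (λ i → if p i ∨ q i then x i else 0ℚ) (λ i → if p i ∧ q i then x i else 0ℚ) (allFin n) ⟨
      sumℚ (λ i → (if p i ∨ q i then x i else 0ℚ) + (if p i ∧ q i then x i else 0ℚ)) (allFin n)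
        ≡⟨ sumℚ-cong modular (allFin n) ⟩
      sumℚ (λ i → (if p i then x i else 0ℚ) + (if q i then x i else 0ℚ)) (allFin n)
        ≡⟨ sumℚ-distrib-+ (λ i → if p i then x i else 0ℚ) (λ i → if q i then x i else 0ℚ) (allFin n) ⟩
      sumOn p x + sumOn q x ∎
      where
      open ≡-Reasoning
      modular : ∀ i → (if p i ∨ q i then x i else 0ℚ) + (if p i ∧ q i then x i else 0ℚ) ≡
                      (if p i then x i else 0ℚ) + (if q i then x i else 0ℚ)
      modular i with p i | q i
      ... | true  | true  = refl
      ... | true  | false = refl
      ... | false | true  = +-comm (x i) 0ℚ
      ... | false | false = refl

    sumOn-toℚ : ∀ p (f : Fin n → ℕ) → sumOn p (λ i → toℚ (f i)) ≡ toℚ (∑ (λ i → if p i then f i else 0) (allFin n))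
    sumOn-toℚ p f = trans (sumℚ-cong push (allFin n)) (sumℚ-toℚ _ (allFin n))
      where
      push : ∀ i → (if p i then toℚ (f i) else 0ℚ) ≡ toℚ (if p i then f i else 0)
      push i with p i
      ... | true  = refl
      ... | false = refl

  ≤-≤-+-tight : ∀ {a A b B} → a ≤ A → b ≤ B → A + B ≤ a + b → a ≡ A × b ≡ B
  ≤-≤-+-tight a≤A b≤B A+B≤a+b =
    ≤-antisym a≤A (≮⇒≥ λ a<A → <-irrefl refl (<-≤-trans (+-mono-<-≤ a<A b≤B) A+B≤a+b)) ,
    ≤-antisym b≤B (≮⇒≥ λ b<B → <-irrefl refl (<-≤-trans (+-mono-≤-< a≤A b<B) A+B≤a+b))

  convex-tight : ∀ {t Y Z θ} → 0ℚ < t → t < 1ℚ → Y ≤ θ → Z ≤ θ → θ ≡ t * Y + (1ℚ - t) * Z → Y ≡ θ × Z ≡ θ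
  convex-tight {t} {Y} {Z} {θ} 0<t t<1 Y≤θ Z≤θ θ≡ =
    ≤-antisym Y≤θ (*-cancelˡ-≤-pos t {{positive 0<t}} (≤-reflexive (sym (proj₁ both)))) ,
    ≤-antisym Z≤θ (*-cancelˡ-≤-pos (1ℚ - t) {{positive 0<1-t}} (≤-reflexive (sym (proj₂ both))))
    where
    0<1-t : 0ℚ < 1ℚ - t
    0<1-t = subst (_< 1ℚ - t) (+-inverseʳ t) (+-monoˡ-< (- t) t<1)
    θ-split : t * θ + (1ℚ - t) * θ ≡ t * Y + (1ℚ - t) * Z
    θ-split = trans (solve 2 (λ t θ → t :* θ :+ (con 1ℚ :- t) :* θ := θ) refl t θ) θ≡
      where open +-*-Solver
    both : t * Y ≡ t * θ × (1ℚ - t) * Z ≡ (1ℚ - t) * θ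
    both = ≤-≤-+-tight (*-monoˡ-≤-nonNeg t {{pos⇒nonNeg t {{positive 0<t}}}} Y≤θ)
                       (*-monoˡ-≤-nonNeg (1ℚ - t) {{pos⇒nonNeg (1ℚ - t) {{positive 0<1-t}}}} Z≤θ)
                       (≤-reflexive θ-split)

  sumOn-prefix-suc : ∀ {n} (w : Permutation′ n) (m : Fin n) (y : Fin n → ℚ) →
                     sumOn (prefix w (suc (toℕ m))) y ≡ sumOn (prefix w (toℕ m)) y + y (w ⟨$⟩ʳ m)
  sumOn-prefix-suc {n} w m y = begin
    sumOn (prefix w (suc (toℕ m))) y
      ≡⟨ sumℚ-cong split (allFin n) ⟩
    sumℚ (λ i → (if prefix w (toℕ m) i then y i else 0ℚ) + (if does (i ≟ w ⟨$⟩ʳ m) then y i else 0ℚ)) (allFin n)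
      ≡⟨ sumℚ-distrib-+ (λ i → if prefix w (toℕ m) i then y i else 0ℚ)
                        (λ i → if does (i ≟ w ⟨$⟩ʳ m) then y i else 0ℚ) (allFin n) ⟩
    sumOn (prefix w (toℕ m)) y + sumℚ (λ i → if does (i ≟ w ⟨$⟩ʳ m) then y i else 0ℚ) (allFin n)
      ≡⟨ cong (sumOn (prefix w (toℕ m)) y +_) (sumℚ-pick (w ⟨$⟩ʳ m) y) ⟩
    sumOn (prefix w (toℕ m)) y + y (w ⟨$⟩ʳ m) ∎
    where
    open ≡-Reasoning
    position-injective : ∀ i → toℕ (w ⟨$⟩ˡ i) ≡ toℕ m → i ≡ w ⟨$⟩ʳ m
    position-injective i eq = trans (sym (inverseʳ w)) (cong (w ⟨$⟩ʳ_) (toℕ-injective eq))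
    split : ∀ i → (if prefix w (suc (toℕ m)) i then y i else 0ℚ) ≡
                  (if prefix w (toℕ m) i then y i else 0ℚ) + (if does (i ≟ w ⟨$⟩ʳ m) then y i else 0ℚ)
    split i with i ≟ w ⟨$⟩ʳ m
    ... | yes refl rewrite prefix-⟨$⟩ʳ w (suc (toℕ m)) m | prefix-⟨$⟩ʳ w (toℕ m) m
                         | <⇒<ᵇ≡true {toℕ m} ℕₚ.≤-refl | ≥⇒<ᵇ≡false {toℕ m} ℕₚ.≤-refl = sym (+-identityˡ _)
    ... | no i≢wm rewrite <ᵇ-suc-≢ {toℕ (w ⟨$⟩ˡ i)} (i≢wm ∘ position-injective i) = sym (+-identityʳ _)

  prefix-sums-determine : ∀ {n} (w : Permutation′ n) (y z : Fin n → ℚ) →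
                          (∀ k → sumOn (prefix w k) y ≡ sumOn (prefix w k) z) → ∀ i → y i ≡ z i
  prefix-sums-determine w y z same i =
    subst (λ j → y j ≡ z j) (inverseʳ w) (∙-cancelˡ Y (y (w ⟨$⟩ʳ m)) (z (w ⟨$⟩ʳ m)) (begin
    Y + y (w ⟨$⟩ʳ m)                 ≡⟨ sumOn-prefix-suc w m y ⟨
    sumOn (prefix w (suc (toℕ m))) y ≡⟨ same (suc (toℕ m)) ⟩
    sumOn (prefix w (suc (toℕ m))) z ≡⟨ sumOn-prefix-suc w m z ⟩
    Z + z (w ⟨$⟩ʳ m)                 ≡⟨ cong (_+ z (w ⟨$⟩ʳ m)) (same (toℕ m)) ⟨
    Y + z (w ⟨$⟩ʳ m)                 ∎))
    where
    open ≡-Reasoning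
    m = w ⟨$⟩ˡ i
    Y = sumOn (prefix w (toℕ m)) y
    Z = sumOn (prefix w (toℕ m)) z

  positive-lower-bound : ∀ m (P : Subset m → Set) → (∀ S → Dec (P S)) → (f : Subset m → ℚ) →
                         (∀ S → P S → 0ℚ < f S) → ∃[ ε ] 0ℚ < ε × (∀ S → P S → ε ≤ f S)
  positive-lower-bound zero P P? f f>0 with P? Vec.[]
  ... | yes P[] = f Vec.[] , f>0 Vec.[] P[] , λ { Vec.[] _ → ≤-refl }
  ... | no ¬P[] = 1ℚ , *<* (ℤ.+<+ ℕ.z<s) , λ { Vec.[] P[] → ⊥-elim (¬P[] P[]) }
  positive-lower-bound (suc m) P P? f f>0
    with positive-lower-bound m (P ∘ (true Vec.∷_)) (P? ∘ (true Vec.∷_)) (f ∘ (true Vec.∷_)) (f>0 ∘ (true Vec.∷_))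
       | positive-lower-bound m (P ∘ (false Vec.∷_)) (P? ∘ (false Vec.∷_)) (f ∘ (false Vec.∷_)) (f>0 ∘ (false Vec.∷_))
  ... | ε₁ , 0<ε₁ , ε₁≤ | ε₂ , 0<ε₂ , ε₂≤ = ε₁ ⊓ ε₂ , 0<ε₁⊓ε₂ , bound
    where
    0<ε₁⊓ε₂ : 0ℚ < ε₁ ⊓ ε₂
    0<ε₁⊓ε₂ with ⊓-sel ε₁ ε₂
    ... | inj₁ eq = subst (0ℚ <_) (sym eq) 0<ε₁
    ... | inj₂ eq = subst (0ℚ <_) (sym eq) 0<ε₂
    bound : ∀ S → P S → ε₁ ⊓ ε₂ ≤ f S
    bound (true  Vec.∷ S) PS = ≤-trans (p⊓q≤p ε₁ ε₂) (ε₁≤ S PS)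
    bound (false Vec.∷ S) PS = ≤-trans (p⊓q≤q ε₁ ε₂) (ε₂≤ S PS)

  0<slack : ∀ {a b} → a ≤ b → a ≢ b → 0ℚ < b - a
  0<slack {a} {b} a≤b a≢b with <-cmp a b
  ... | tri< a<b _ _ = subst (_< b - a) (+-inverseʳ a) (+-monoˡ-< (- a) a<b)
  ... | tri≈ _ a≡b _ = ⊥-elim (a≢b a≡b)
  ... | tri> _ _ b<a = ⊥-elim (<-irrefl refl (<-≤-trans b<a a≤b))

  𝟙ℚ : Bool → ℚ
  𝟙ℚ b = if b then 1ℚ else 0ℚ

  shift-same : ∀ δ b → δ * (𝟙ℚ b + - 1ℚ * 𝟙ℚ b) ≡ 0ℚ
  shift-same δ true  = *-zeroʳ δ
  shift-same δ false = *-zeroʳ δ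

  shift-≤ : ∀ δ ε a b → δ ≤ ε → - δ ≤ ε → 0ℚ ≤ ε → δ * (𝟙ℚ a + - 1ℚ * 𝟙ℚ b) ≤ ε
  shift-≤ δ ε true  true  _   _    0≤ε = subst (_≤ ε) (sym (*-zeroʳ δ)) 0≤ε
  shift-≤ δ ε true  false δ≤ε _    _   = subst (_≤ ε) (sym (*-identityʳ δ)) δ≤ε
  shift-≤ δ ε false true  _   -δ≤ε _   = subst (_≤ ε) (sym (solve 1 (λ δ → δ :* (:- con 1ℚ) := :- δ) refl δ)) -δ≤ε
    where open +-*-Solver
  shift-≤ δ ε false false _   _    0≤ε = subst (_≤ ε) (sym (*-zeroʳ δ)) 0≤ε

  midpoint : ∀ a e d → a ≡ ½ * (a + e * d) + (1ℚ - ½) * (a + (- e) * d)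
  midpoint = solve 3 (λ a e d → a := con ½ :* (a :+ e :* d) :+ (con 1ℚ :- con ½) :* (a :+ (:- e) :* d)) refl
    where open +-*-Solver

  -p<p : ∀ {p} → 0ℚ < p → - p < p
  -p<p 0<p = <-trans (neg-antimono-< 0<p) 0<p

  opposite-shifts-differ : ∀ a {e} → 0ℚ < e → a + e * 1ℚ ≢ a + (- e) * 1ℚ
  opposite-shifts-differ a {e} 0<e eq = <-irrefl -e≡e (-p<p 0<e)
    where
    open ≡-Reasoning
    -e≡e : - e ≡ e
    -e≡e = begin
      - e       ≡⟨ *-identityʳ (- e) ⟨
      - e * 1ℚ  ≡⟨ ∙-cancelˡ a (e * 1ℚ) (- e * 1ℚ) eq ⟨
      e * 1ℚ    ≡⟨ *-identityʳ e ⟩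
      e         ∎

  0<½ : 0ℚ < ½
  0<½ = *<* (ℤ.+<+ ℕ.z<s)

  ½<1 : ½ < 1ℚ
  ½<1 = *<* (ℤ.+<+ (ℕ.s<s ℕ.z<s))

  module Schubitope {n : ℕ} (D : Diagram n) where

    Tight : (Fin n → ℚ) → (Fin n → Bool) → Set
    Tight x p = sumOn p x ≡ toℚ (θᵇ D p)

    Tight? : ∀ x p → Dec (Tight x p)
    Tight? x p = sumOn p x ≟ℚ toℚ (θᵇ D p)

    Tight-cong : ∀ {x p q} → (∀ i → p i ≡ q i) → Tight x p → Tight x q
    Tight-cong p≗q tight = trans (sumOn-cong (sym ∘ p≗q) (λ _ → refl)) (trans tight (cong toℚ (θᵇ-cong D p≗q)))

    InSchubitope-cong : ∀ {x y} → (∀ i → x i ≡ y i) → InSchubitope D y → InSchubitope D x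
    InSchubitope-cong x≗y (total , bounded) =
      trans (sumℚ-cong x≗y (allFin n)) total ,
      λ S S≢⊤ → subst (_≤ toℚ (θ D S)) (sumOn-cong {p = lookup S} (λ _ → refl) (sym ∘ x≗y)) (bounded S S≢⊤)

    module _ {x : Fin n → ℚ} (x∈ : InSchubitope D x) where

      sumOn≤θᵇ : ∀ p → sumOn p x ≤ toℚ (θᵇ D p)
      sumOn≤θᵇ p = by-cases (all? (λ i → p i Boolₚ.≟ true))
        where
        by-cases : Dec (∀ i → p i ≡ true) → sumOn p x ≤ toℚ (θᵇ D p)
        by-cases (yes p≗⊤) = ≤-reflexive (begin
          sumOn p x                ≡⟨ sumOn-cong p≗⊤ (λ _ → refl) ⟩
          sumℚ x (allFin n)        ≡⟨ proj₁ x∈ ⟩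
          toℚ (size D)             ≡⟨ cong toℚ (θᵇ-all D) ⟨
          toℚ (θᵇ D (λ _ → true))  ≡⟨ cong toℚ (θᵇ-cong D (sym ∘ p≗⊤)) ⟩
          toℚ (θᵇ D p)             ∎)
          where open ≡-Reasoning
        by-cases (no p≉⊤) = subst₂ _≤_ (sumOn-cong (lookup∘tabulate p) (λ _ → refl))
                                       (cong toℚ (trans (θ≡θᵇ D (Vec.tabulate p)) (θᵇ-cong D (lookup∘tabulate p))))
                                       (proj₂ x∈ (Vec.tabulate p) S≢⊤)
          where
          S≢⊤ : Vec.tabulate p ≢ ⊤
          S≢⊤ S≡⊤ = p≉⊤ (λ i → trans (sym (lookup∘tabulate p i))
                                     (trans (cong (λ S → lookup S i) S≡⊤) (lookup-replicate i true)))

      Tight-all : Tight x (λ _ → true)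
      Tight-all = trans (proj₁ x∈) (cong toℚ (sym (θᵇ-all D)))

      Tight-none : Tight x (λ _ → false)
      Tight-none = trans (sumℚ-zero (λ _ → refl) (allFin n)) (cong toℚ (sym (θᵇ-none D)))

      -- Submodularity of θ against modularity of the sum.
      Tight-∨-∧ : ∀ {p q} → Tight x p → Tight x q → Tight x (λ i → p i ∨ q i) × Tight x (λ i → p i ∧ q i)
      Tight-∨-∧ {p} {q} tp tq = ≤-≤-+-tight (sumOn≤θᵇ (λ i → p i ∨ q i)) (sumOn≤θᵇ (λ i → p i ∧ q i)) (begin
        toℚ (θᵇ D (λ i → p i ∨ q i)) + toℚ (θᵇ D (λ i → p i ∧ q i)) ≡⟨ toℚ-+ (θᵇ D (λ i → p i ∨ q i)) (θᵇ D (λ i → p i ∧ q i)) ⟨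
        toℚ (θᵇ D (λ i → p i ∨ q i) ℕ.+ θᵇ D (λ i → p i ∧ q i))     ≤⟨ toℚ-mono-≤ (θᵇ-submodular D p q) ⟩
        toℚ (θᵇ D p ℕ.+ θᵇ D q)                                      ≡⟨ toℚ-+ (θᵇ D p) (θᵇ D q) ⟩
        toℚ (θᵇ D p) + toℚ (θᵇ D q)                                  ≡⟨ cong₂ _+_ tp tq ⟨
        sumOn p x + sumOn q x                                        ≡⟨ sumOn-∨+sumOn-∧ p q x ⟨
        sumOn (λ i → p i ∨ q i) x + sumOn (λ i → p i ∧ q i) x        ∎)
        where open ≤-Reasoning

    tight-chain⇒vertex : ∀ {x} w → InSchubitope D x → (∀ k → Tight x (prefix w k)) → IsVertex D x
    tight-chain⇒vertex {x} w x∈ tight = x∈ , extreme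
      where
      extreme : ∀ y z t → InSchubitope D y → InSchubitope D z → 0ℚ < t → t < 1ℚ →
                (∀ i → x i ≡ t * y i + (1ℚ - t) * z i) → ∀ i → y i ≡ z i
      extreme y z t y∈ z∈ 0<t t<1 x≡ty+[1-t]z = prefix-sums-determine w y z λ k →
        let P = prefix w k
            (Y≡θ , Z≡θ) = convex-tight 0<t t<1 (sumOn≤θᵇ y∈ P) (sumOn≤θᵇ z∈ P) (begin
              toℚ (θᵇ D P)                                     ≡⟨ tight k ⟨
              sumOn P x                                        ≡⟨ sumOn-cong {p = P} (λ _ → refl) x≡ty+[1-t]z ⟩
              sumOn P (λ i → t * y i + (1ℚ - t) * z i)         ≡⟨ sumOn-+ P (λ i → t * y i) (λ i → (1ℚ - t) * z i) ⟩
              sumOn P (λ i → t * y i) + sumOn P (λ i → (1ℚ - t) * z i)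
                                                               ≡⟨ cong₂ _+_ (sumOn-*ˡ P t y) (sumOn-*ˡ P (1ℚ - t) z) ⟩
              t * sumOn P y + (1ℚ - t) * sumOn P z             ∎)
        in trans Y≡θ (sym Z≡θ)
        where open ≡-Reasoning

    xℚ : Permutation′ n → Fin n → ℚ
    xℚ w k = toℚ (xw D w k)

    xℚ-tight : ∀ w k → Tight (xℚ w) (prefix w k)
    xℚ-tight w k = trans (sumOn-toℚ (prefix w k) (xw D w)) (cong toℚ (xw-prefix≡θᵇ D w k))

    xℚ∈ : ∀ w → InSchubitope D (xℚ w)
    xℚ∈ w = total , λ S _ → subst (sumOn (lookup S) (xℚ w) ≤_) (cong toℚ (sym (θ≡θᵇ D S))) (bounded (lookup S))
      where
      prefix-n≡⊤ : ∀ i → prefix w n i ≡ true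
      prefix-n≡⊤ i = <⇒<ᵇ≡true (toℕ<n (w ⟨$⟩ˡ i))
      total : sumℚ (xℚ w) (allFin n) ≡ toℚ (size D)
      total = begin
        sumℚ (xℚ w) (allFin n)          ≡⟨ sumOn-cong (sym ∘ prefix-n≡⊤) (λ _ → refl) ⟩
        sumOn (prefix w n) (xℚ w)       ≡⟨ xℚ-tight w n ⟩
        toℚ (θᵇ D (prefix w n))         ≡⟨ cong toℚ (θᵇ-cong D prefix-n≡⊤) ⟩
        toℚ (θᵇ D (λ _ → true))         ≡⟨ cong toℚ (θᵇ-all D) ⟩
        toℚ (size D)                    ∎
        where open ≡-Reasoning
      bounded : ∀ p → sumOn p (xℚ w) ≤ toℚ (θᵇ D p)
      bounded p = subst (_≤ toℚ (θᵇ D p)) (sym (sumOn-toℚ p (xw D w))) (toℚ-mono-≤ (xw-≤θᵇ D w p))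

    -- If no tight set separates i from j, then x ± ε(eᵢ − eⱼ) stay in the Schubitope for small ε > 0.
    module Perturbation {x : Fin n → ℚ} (x-vertex : IsVertex D x) (i j : Fin n) (i≢j : i ≢ j)
      (unseparated : ∀ (S : Subset n) → Tight x (lookup S) → lookup S i ≡ lookup S j) where

      x∈ : InSchubitope D x
      x∈ = proj₁ x-vertex

      slack : Subset n → ℚ
      slack S = toℚ (θᵇ D (lookup S)) - sumOn (lookup S) x

      ε-spec : ∃[ ε ] 0ℚ < ε × (∀ S → ¬ Tight x (lookup S) → ε ≤ slack S)
      ε-spec = positive-lower-bound n (λ S → ¬ Tight x (lookup S)) (λ S → ¬? (Tight? x (lookup S))) slack
                                    (λ S ¬tight → 0<slack (sumOn≤θᵇ x∈ (lookup S)) ¬tight)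

      ε : ℚ
      ε = proj₁ ε-spec

      0<ε : 0ℚ < ε
      0<ε = proj₁ (proj₂ ε-spec)

      direction : Fin n → ℚ
      direction k = 𝟙ℚ (does (k ≟ i)) + - 1ℚ * 𝟙ℚ (does (k ≟ j))

      -- Opaque so that conversion checking never unfolds rational arithmetic.
      opaque
        moved : ℚ → Fin n → ℚ
        moved δ k = x k + δ * direction k

        moved-≡ : ∀ δ k → moved δ k ≡ x k + δ * direction k
        moved-≡ δ k = refl

      sumOn-moved : ∀ δ p → sumOn p (moved δ) ≡ sumOn p x + δ * (𝟙ℚ (p i) + - 1ℚ * 𝟙ℚ (p j))
      sumOn-moved δ p = begin
        sumOn p (moved δ)                              ≡⟨ sumOn-cong {p = p} (λ _ → refl) (moved-≡ δ) ⟩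
        sumOn p (λ k → x k + δ * direction k)          ≡⟨ sumOn-+ p x (λ k → δ * direction k) ⟩
        sumOn p x + sumOn p (λ k → δ * direction k)    ≡⟨ cong (sumOn p x +_) (sumOn-*ˡ p δ direction) ⟩
        sumOn p x + δ * sumOn p direction              ≡⟨ cong (λ d → sumOn p x + δ * d) sumOn-direction ⟩
        sumOn p x + δ * (𝟙ℚ (p i) + - 1ℚ * 𝟙ℚ (p j))   ∎
        where
        open ≡-Reasoning
        sumOn-direction : sumOn p direction ≡ 𝟙ℚ (p i) + - 1ℚ * 𝟙ℚ (p j)
        sumOn-direction = trans (sumOn-+ p (λ k → 𝟙ℚ (does (k ≟ i))) (λ k → - 1ℚ * 𝟙ℚ (does (k ≟ j))))
                                (cong₂ _+_ (sumOn-pick p i 1ℚ)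
                                           (trans (sumOn-*ˡ p (- 1ℚ) (λ k → 𝟙ℚ (does (k ≟ j))))
                                                  (cong (- 1ℚ *_) (sumOn-pick p j 1ℚ))))

      moved∈ : ∀ δ → δ ≤ ε → - δ ≤ ε → InSchubitope D (moved δ)
      moved∈ δ δ≤ε -δ≤ε = total , bounded
        where
        total : sumℚ (moved δ) (allFin n) ≡ toℚ (size D)
        total = trans (sumOn-moved δ (λ _ → true))
                      (trans (cong (sumℚ x (allFin n) +_) (shift-same δ true))
                             (trans (+-identityʳ _) (proj₁ x∈)))
        bounded : ∀ S → S ≢ ⊤ → sumOn (lookup S) (moved δ) ≤ toℚ (θ D S)
        bounded S _ = subst₂ _≤_ (sym (sumOn-moved δ (lookup S))) (cong toℚ (sym (θ≡θᵇ D S)))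
                                 (by-cases (Tight? x (lookup S)))
          where
          open +-*-Solver
          Sx = sumOn (lookup S) x
          shift = δ * (𝟙ℚ (lookup S i) + - 1ℚ * 𝟙ℚ (lookup S j))
          by-cases : Dec (Tight x (lookup S)) → Sx + shift ≤ toℚ (θᵇ D (lookup S))
          by-cases (yes tight) = begin
            Sx + shift                                          ≡⟨ cong (λ b → Sx + δ * (𝟙ℚ (lookup S i) + - 1ℚ * 𝟙ℚ b))
                                                                        (unseparated S tight) ⟨
            Sx + δ * (𝟙ℚ (lookup S i) + - 1ℚ * 𝟙ℚ (lookup S i))  ≡⟨ cong (Sx +_) (shift-same δ (lookup S i)) ⟩
            Sx + 0ℚ                                             ≡⟨ +-identityʳ Sx ⟩
            Sx                                                  ≤⟨ sumOn≤θᵇ x∈ (lookup S) ⟩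
            toℚ (θᵇ D (lookup S))                               ∎
            where open ≤-Reasoning
          by-cases (no ¬tight) = begin
            Sx + shift             ≤⟨ +-monoʳ-≤ Sx (≤-trans (shift-≤ δ ε (lookup S i) (lookup S j) δ≤ε -δ≤ε (<⇒≤ 0<ε))
                                                            (proj₂ (proj₂ ε-spec) S ¬tight)) ⟩
            Sx + slack S           ≡⟨ solve 2 (λ a b → a :+ (b :- a) := b) refl Sx (toℚ (θᵇ D (lookup S))) ⟩
            toℚ (θᵇ D (lookup S))  ∎
            where open ≤-Reasoning

      x-midpoint : ∀ k → x k ≡ ½ * moved ε k + (1ℚ - ½) * moved (- ε) k
      x-midpoint k = trans (midpoint (x k) ε (direction k))
                           (sym (cong₂ (λ a b → ½ * a + (1ℚ - ½) * b) (moved-≡ ε k) (moved-≡ (- ε) k)))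

      moved-apart : moved ε i ≢ moved (- ε) i
      moved-apart eq = opposite-shifts-differ (x i) 0<ε
        (subst (λ d → x i + ε * d ≡ x i + (- ε) * d) direction-i
               (trans (sym (moved-≡ ε i)) (trans eq (moved-≡ (- ε) i))))
        where
        direction-i : direction i ≡ 1ℚ
        direction-i = cong₂ (λ a b → 𝟙ℚ a + - 1ℚ * 𝟙ℚ b) (dec-true (i ≟ i) refl) (dec-false (i ≟ j) i≢j)

      impossible : ⊥
      impossible = moved-apart (proj₂ x-vertex (moved ε) (moved (- ε)) ½
        (moved∈ ε ≤-refl (<⇒≤ (-p<p 0<ε))) (moved∈ (- ε) (<⇒≤ (-p<p 0<ε)) (≤-reflexive (⁻¹-involutive ε)))
        0<½ ½<1 x-midpoint i)

    vertex-separates : ∀ {x} → IsVertex D x → ∀ i j → i ≢ j → ∃[ S ] Tight x S × S i ≢ S j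
    vertex-separates {x} x-vertex i j i≢j =
      by-cases (anySubset? (λ S → Tight? x (lookup S) ×-dec ¬? (lookup S i Boolₚ.≟ lookup S j)))
      where
      by-cases : Dec (∃[ S ] Tight x (lookup S) × lookup S i ≢ lookup S j) → ∃[ S ] Tight x S × S i ≢ S j
      by-cases (yes (S , tight , Si≢Sj)) = lookup S , tight , Si≢Sj
      by-cases (no ∄S) = ⊥-elim (Perturbation.impossible x-vertex i j i≢j unseparated)
        where
        unseparated : ∀ S → Tight x (lookup S) → lookup S i ≡ lookup S j
        unseparated S tight = decidable-stable (lookup S i Boolₚ.≟ lookup S j) (λ Si≢Sj → ∄S (S , tight , Si≢Sj))

    vertex⇒tight-chain : ∀ {x} → IsVertex D x → ∃[ w ] (∀ k → Tight x (prefix w k))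
    vertex⇒tight-chain {x} x-vertex = TightChain.tight-chain (Tight x) Tight-cong
      (λ tp tq → proj₁ (Tight-∨-∧ x∈ tp tq)) (λ tp tq → proj₂ (Tight-∨-∧ x∈ tp tq))
      (Tight-none x∈) (Tight-all x∈) (vertex-separates x-vertex)
      where
      x∈ : InSchubitope D x
      x∈ = proj₁ x-vertex


open Combinatorics using (prefix)
open Geometry using (module Schubitope; sumOn-cong; prefix-sums-determine)
open import Data.Nat using (ℕ; _≤_)
open import Data.Rational using (ℚ)

theorem1p1 : (n : ℕ) → 1 ≤ n → (D : Diagram n) → (x : Fin n → ℚ) →
    IsVertex D x ⇔ (∃[ w ] (∀ (k : Fin n) → x k ≡ toℚ (xw D w k)))
theorem1p1 n _ D x = mk⇔ vertex⇒filling filling⇒vertex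
  where
  open Schubitope D
  vertex⇒filling : IsVertex D x → ∃[ w ] (∀ k → x k ≡ toℚ (xw D w k))
  vertex⇒filling x-vertex =
    let w , tight = vertex⇒tight-chain x-vertex
    in w , prefix-sums-determine w x (xℚ w) (λ k → trans (tight k) (sym (xℚ-tight w k)))
  filling⇒vertex : ∃[ w ] (∀ k → x k ≡ toℚ (xw D w k)) → IsVertex D x
  filling⇒vertex (w , x≗xw) = tight-chain⇒vertex w (InSchubitope-cong x≗xw (xℚ∈ w))
    (λ k → trans (sumOn-cong {p = prefix w k} (λ _ → refl) x≗xw) (xℚ-tight w k))
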